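{- Let $\ell\ge 7$ be odd. There exist an integer $m\in\{(\ell-5)/2,(\ell-3)/2,(\ell-1)/2,(\ell+1)/2\}$ and two $\ell$-cycles $C_0$ and $C_1$ on vertex set $\mathbb{Z}_{2\ell}\times\{0,1\}$ such that: the edges of $C_0$ and $C_1$ together consist of exactly one edge of mixed difference $d$ for each $d\in \mathbb{Z}_{2\ell}\setminus\{0,\ell\}$, one edge of $C_0$ of $0$-pure difference $\pm m$, and one edge of $C_1$ of $1$-pure difference $\pm m$; and, for $i=0,1$ and every $t\in\mathbb{Z}_{2\ell}$, the translate $C_i+t$ is equitably coloured under the colouring described below.
   Context: Write $a_i$ for the vertex $(a,i)\in \mathbb{Z}_{2\ell}\times\{0,1\}$. An edge $a_0 b_1$ has mixed difference $b-a \pmod{2\ell}$; an edge $a_i b_i$ (same $i$) has $i$-pure difference $\pm(b-a)\pmod{2\ell}$. For a cycle $C$ and $t\in\mathbb{Z}_{2\ell}$, the translate $C+t$ is the cycle obtained by replacing each vertex $a_i$ by $(a+t)_i$. The colouring: a vertex $a_0$ is red if $a\in\{0,1,\dots,\ell-1\}$ and blue if $a\in\{\ell,\dots,2\ell-1\}$; a vertex $a_1$ is blue if $a\in\{0,\dots,\ell-1\}$ and red if $a\in\{\ell,\dots,2\ell-1\}$. An $\ell$-cycle is equitably coloured if it contains $(\ell-1)/2$ or $(\ell+1)/2$ red vertices. -}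

module Defs where

open import Data.Nat using (ℕ; zero; suc; _+_; _*_; _∸_; _≡ᵇ_; _<ᵇ_; NonZero)
open import Data.Nat.DivMod using (_%_; m%n<n)
open import Data.Fin using (Fin; toℕ; fromℕ<; zero; suc)
open import Data.Product using (_×_; _,_)
open import Data.Bool using (Bool; true; false; not; _∧_; _∨_; if_then_else_)
open import Relation.Binary.PropositionalEquality using (_≡_)
open import Function.Definitions using (Injective)

-- ℤ_{2ℓ} is represented by Fin (ℓ + ℓ); levels {0,1} by Fin 2.
Vtx : ℕ → Set
Vtx ℓ = Fin (ℓ + ℓ) × Fin 2

addZ : (ℓ : ℕ) .{{_ : NonZero (ℓ + ℓ)}} → Fin (ℓ + ℓ) → Fin (ℓ + ℓ) → Fin (ℓ + ℓ)
addZ ℓ a b = fromℕ< (m%n<n (toℕ a + toℕ b) (ℓ + ℓ))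

diffZ : (ℓ : ℕ) .{{_ : NonZero (ℓ + ℓ)}} → Fin (ℓ + ℓ) → Fin (ℓ + ℓ) → ℕ
diffZ ℓ a b = (toℕ b + ((ℓ + ℓ) ∸ toℕ a)) % (ℓ + ℓ)

sucMod : {h : ℕ} → Fin (suc h) → Fin (suc h)
sucMod {h} i = fromℕ< (m%n<n (suc (toℕ i)) (suc h))

-- an ℓ-cycle (ℓ = suc h) on Vtx L: distinct vertices v_0,...,v_{ℓ-1},
-- edges v_i v_{i+1 mod ℓ}
record Cycle (L h : ℕ) : Set where
  field
    vs  : Fin (suc h) → Vtx L
    inj : Injective _≡_ _≡_ vs
open Cycle public

Edge : ℕ → Set
Edge L = Vtx L × Vtx L

edge : {L h : ℕ} → Cycle L h → Fin (suc h) → Edge L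
edge C i = vs C i , vs C (sucMod i)

isLevel0 : Fin 2 → Bool
isLevel0 zero = true
isLevel0 (suc _) = false

isMixedWith : (ℓ : ℕ) .{{_ : NonZero (ℓ + ℓ)}} → ℕ → Edge ℓ → Bool
isMixedWith ℓ d ((a , zero) , (b , zero)) = false
isMixedWith ℓ d ((a , zero) , (b , suc _)) = diffZ ℓ a b ≡ᵇ d
isMixedWith ℓ d ((a , suc _) , (b , zero)) = diffZ ℓ b a ≡ᵇ d
isMixedWith ℓ d ((a , suc _) , (b , suc _)) = false

isPureWith : (ℓ : ℕ) .{{_ : NonZero (ℓ + ℓ)}} → Fin 2 → ℕ → Edge ℓ → Bool
isPureWith ℓ i m ((a , j) , (b , j')) =
  (isLevel0 j ≡ᵇ' isLevel0 i) ∧ (isLevel0 j' ≡ᵇ' isLevel0 i) ∧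
  ((diffZ ℓ a b ≡ᵇ (m % (ℓ + ℓ))) ∨ (diffZ ℓ a b ≡ᵇ (((ℓ + ℓ) ∸ m) % (ℓ + ℓ))))
  where
  _≡ᵇ'_ : Bool → Bool → Bool
  true ≡ᵇ' y = y
  false ≡ᵇ' y = not y

isMixed : (ℓ : ℕ) → Edge ℓ → Bool
isMixed ℓ ((a , j) , (b , j')) = not (isLevel0 j ∧ isLevel0 j') ∧ (isLevel0 j ∨ isLevel0 j')

countF : (n : ℕ) → (Fin n → Bool) → ℕ
countF zero P = 0
countF (suc n) P = (if P zero then 1 else 0) + countF n (λ i → P (suc i))

isRed : (ℓ : ℕ) → Vtx ℓ → Bool
isRed ℓ (a , zero) = toℕ a <ᵇ ℓ
isRed ℓ (a , suc _) = not (toℕ a <ᵇ ℓ)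

translate : (ℓ : ℕ) .{{_ : NonZero (ℓ + ℓ)}} {h : ℕ} → Cycle ℓ h → Fin (ℓ + ℓ) → Fin (suc h) → Vtx ℓ
translate ℓ C t i with vs C i
... | (a , j) = addZ ℓ a t , j

redCount : (ℓ : ℕ) .{{_ : NonZero (ℓ + ℓ)}} {h : ℕ} → Cycle ℓ h → Fin (ℓ + ℓ) → ℕ
redCount ℓ {h} C t = countF (suc h) (λ i → isRed ℓ (translate ℓ C t i))

-- Both cycles are mirror symmetric: for 1 ≤ Z ≤ k-1 the vertex at position ℓ-Z is the vertex at
-- position Z moved to the other level.  Along positions 1 … k-1 the signed values (the value on
-- level 1, its negative on level 0) run through a zigzag α, β, α+1, β+1, …, so the mixed differences,
-- being sums of consecutive signed values, fill an interval; the mirrored half yields the negated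
-- interval.  Together with the first edge and the three edges around the centre, whose differences
-- depend only on the level of position k-1, the two cycles have exactly the mixed differences
-- ±1, …, ±2k.  A vertex and its mirror image have opposite colours in every translate, so a translate
-- of either cycle has k-1 red vertices among the mirrored pairs, plus 1 or 2 among positions 0, k and
-- k+1: these three points of ℤ_{2ℓ} have consecutive gaps at most ℓ, so no half circle contains all
-- or none of them.  Injectivity is checked by decoding every value back to its position.

module Submission where

open import Defs
open import Data.Nat using (ℕ; zero; suc; _+_; _*_; _∸_; _≤_; _<_; _≡ᵇ_; _<ᵇ_; z≤n; s≤s)
open import Data.Nat.Properties
open import Data.Nat.DivMod using (_%_; _/_; m%n<n; m%n≤n; m≡m%n+[m/n]*n; [m+n]%n≡m%n; [m+kn]%n≡m%n; %-distribˡ-+; m%n%n≡m%n; m<n⇒m%n≡m; n%n≡0)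
open import Data.Nat.Tactic.RingSolver using (solve-∀)
open import Algebra.Properties.CommutativeSemigroup +-commutativeSemigroup using (xy∙z≈xz∙y)
open import Data.Fin using (Fin; toℕ; fromℕ<)
open import Data.Fin.Properties using (toℕ-fromℕ<; toℕ-injective; toℕ<n)
open import Data.Product using (Σ; _×_; _,_; proj₁; proj₂)
open import Data.Sum using (_⊎_; inj₁; inj₂)
open import Data.Bool using (Bool; true; false; not; if_then_else_; T; _∨_)
open import Data.Bool.Properties using (not-involutive; not-¬; ∨-zeroʳ)
open import Data.Unit using (tt)
open import Data.Empty using (⊥)
open import Function using (_∘_)
open import Relation.Binary.PropositionalEquality
open import Relation.Nullary using (¬_; contradiction; yes; no)
open import Relation.Nullary.Decidable using (dec-true; dec-false)

≤-by : ∀ {a b} e → a + e ≡ b → a ≤ b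
≤-by {a} e refl = m≤m+n a e

<-by : ∀ {a b} e → a + suc e ≡ b → a < b
<-by {a} e refl = m<m+n a (s≤s z≤n)

if-true : ∀ {A : Set} {b} {x y : A} → b ≡ true → (if b then x else y) ≡ x
if-true refl = refl

if-false : ∀ {A : Set} {b} {x y : A} → b ≡ false → (if b then x else y) ≡ y
if-false refl = refl

-- Counting

indicator : Bool → ℕ
indicator b = if b then 1 else 0

count : ℕ → (ℕ → Bool) → ℕ
count zero    P = 0
count (suc n) P = indicator (P 0) + count n (P ∘ suc)

countF-toℕ : ∀ n (P : ℕ → Bool) → countF n (P ∘ toℕ) ≡ count n P
countF-toℕ zero    P = refl
countF-toℕ (suc n) P = cong (indicator (P 0) +_) (countF-toℕ n (P ∘ suc))

countF-cong : ∀ n {P Q : Fin n → Bool} → (∀ i → P i ≡ Q i) → countF n P ≡ countF n Q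
countF-cong zero    eq = refl
countF-cong (suc n) eq = cong₂ (λ b c → indicator b + c) (eq Fin.zero) (countF-cong n (eq ∘ Fin.suc))

count-cong : ∀ n {P Q : ℕ → Bool} → (∀ x → x < n → P x ≡ Q x) → count n P ≡ count n Q
count-cong zero    eq = refl
count-cong (suc n) eq = cong₂ (λ b c → indicator b + c) (eq 0 (s≤s z≤n)) (count-cong n (λ x x<n → eq (suc x) (s≤s x<n)))

count-+ : ∀ m n (P : ℕ → Bool) → count (m + n) P ≡ count m P + count n (λ x → P (m + x))
count-+ zero    n P = refl
count-+ (suc m) n P = trans (cong (indicator (P 0) +_) (count-+ m n (P ∘ suc))) (sym (+-assoc (indicator (P 0)) _ _))

count-snoc : ∀ n (P : ℕ → Bool) → count (suc n) P ≡ count n P + indicator (P n)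
count-snoc zero    P = +-comm (indicator (P 0)) 0
count-snoc (suc n) P = trans (cong (indicator (P 0) +_) (count-snoc n (P ∘ suc))) (sym (+-assoc (indicator (P 0)) _ _))

count-reverse : ∀ n (P : ℕ → Bool) → count n (λ x → P (n ∸ suc x)) ≡ count n P
count-reverse zero    P = refl
count-reverse (suc n) P = begin
  indicator (P n) + count n (λ x → P (n ∸ suc x)) ≡⟨ cong (indicator (P n) +_) (count-reverse n P) ⟩
  indicator (P n) + count n P                      ≡⟨ +-comm (indicator (P n)) _ ⟩
  count n P + indicator (P n)                      ≡⟨ count-snoc n P ⟨
  count (suc n) P                                  ∎
  where open ≡-Reasoning

count-complement : ∀ n (P : ℕ → Bool) → count n P + count n (not ∘ P) ≡ n
count-complement zero    P = refl
count-complement (suc n) P = begin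
  indicator (P 0) + count n (P ∘ suc) + (indicator (not (P 0)) + count n (not ∘ P ∘ suc))
    ≡⟨ regroup (indicator (P 0)) (count n (P ∘ suc)) (indicator (not (P 0))) (count n (not ∘ P ∘ suc)) ⟩
  (indicator (P 0) + indicator (not (P 0))) + (count n (P ∘ suc) + count n (not ∘ P ∘ suc))
    ≡⟨ cong₂ _+_ (indicator-complement (P 0)) (count-complement n (P ∘ suc)) ⟩
  suc n ∎
  where
  open ≡-Reasoning
  regroup : ∀ a b c d → a + b + (c + d) ≡ (a + c) + (b + d)
  regroup = solve-∀
  indicator-complement : ∀ b → indicator b + indicator (not b) ≡ 1
  indicator-complement true  = refl
  indicator-complement false = refl

count-none : ∀ n {P : ℕ → Bool} → (∀ x → x < n → P x ≡ false) → count n P ≡ 0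
count-none zero    none = refl
count-none (suc n) none rewrite none 0 (s≤s z≤n) = count-none n (λ x x<n → none (suc x) (s≤s x<n))

window : ℕ → ℕ → ℕ → ℕ
window lo n d = count n (λ x → lo + x ≡ᵇ d)

window-+ : ∀ lo m n d → window lo m d + window (lo + m) n d ≡ window lo (m + n) d
window-+ lo m n d = sym (trans (count-+ m n _)
  (cong (window lo m d +_) (count-cong n (λ x _ → cong (_≡ᵇ d) (sym (+-assoc lo m x))))))

window-∋ : ∀ lo n d → lo ≤ d → d < lo + n → window lo n d ≡ 1
window-∋ (suc lo) n (suc d) (s≤s lo≤d) d<lo+n = window-∋ lo n d lo≤d (≤-pred d<lo+n)
window-∋ zero (suc n) zero lo≤d d<n = cong suc (count-zero n)
  where
  count-zero : ∀ n → count n (λ x → suc x ≡ᵇ 0) ≡ 0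
  count-zero zero    = refl
  count-zero (suc n) = count-zero n
window-∋ zero (suc n) (suc d) lo≤d (s≤s d<n) = window-∋ zero n d z≤n d<n

window-∌ : ∀ lo d → lo ≢ d → window lo 1 d ≡ 0
window-∌ lo d lo≢d rewrite dec-false (lo + 0 ≟ d) (lo≢d ∘ trans (sym (+-identityʳ lo))) = refl

window-single : ∀ v d → window v 1 d ≡ indicator (v ≡ᵇ d)
window-single v d = trans (+-identityʳ _) (cong (λ w → indicator (w ≡ᵇ d)) (+-identityʳ v))

merge₆ : ∀ {a b₂ b₃ b₄ b₅ b₆} m₁ m₂ m₃ m₄ m₅ m₆ d →
  a + m₁ ≡ b₂ → a + (m₁ + m₂) ≡ b₃ → a + (m₁ + m₂ + m₃) ≡ b₄ → a + (m₁ + m₂ + m₃ + m₄) ≡ b₅ →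
  a + (m₁ + m₂ + m₃ + m₄ + m₅) ≡ b₆ →
  window a m₁ d + window b₂ m₂ d + window b₃ m₃ d + window b₄ m₄ d + window b₅ m₅ d + window b₆ m₆ d
    ≡ window a (m₁ + m₂ + m₃ + m₄ + m₅ + m₆) d
merge₆ {a} m₁ m₂ m₃ m₄ m₅ m₆ d refl refl refl refl refl = begin
  window a m₁ d + window (a + m₁) m₂ d + w₃ + w₄ + w₅ + w₆
    ≡⟨ cong (λ x → x + w₃ + w₄ + w₅ + w₆) (window-+ a m₁ m₂ d) ⟩
  window a (m₁ + m₂) d + w₃ + w₄ + w₅ + w₆
    ≡⟨ cong (λ x → x + w₄ + w₅ + w₆) (window-+ a (m₁ + m₂) m₃ d) ⟩
  window a (m₁ + m₂ + m₃) d + w₄ + w₅ + w₆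
    ≡⟨ cong (λ x → x + w₅ + w₆) (window-+ a (m₁ + m₂ + m₃) m₄ d) ⟩
  window a (m₁ + m₂ + m₃ + m₄) d + w₅ + w₆
    ≡⟨ cong (_+ w₆) (window-+ a (m₁ + m₂ + m₃ + m₄) m₅ d) ⟩
  window a (m₁ + m₂ + m₃ + m₄ + m₅) d + w₆
    ≡⟨ window-+ a (m₁ + m₂ + m₃ + m₄ + m₅) m₆ d ⟩
  window a (m₁ + m₂ + m₃ + m₄ + m₅ + m₆) d ∎
  where
  open ≡-Reasoning
  w₃ w₄ w₅ w₆ : ℕ
  w₃ = window (a + (m₁ + m₂)) m₃ d
  w₄ = window (a + (m₁ + m₂ + m₃)) m₄ d
  w₅ = window (a + (m₁ + m₂ + m₃ + m₄)) m₅ d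
  w₆ = window (a + (m₁ + m₂ + m₃ + m₄ + m₅)) m₆ d

merge : ∀ {a m b} n d → a + m ≡ b → window a m d + window b n d ≡ window a (m + n) d
merge {a} {m} n d refl = window-+ a m n d

-- Parity

alternate : Bool → ℕ → Bool
alternate x zero    = x
alternate x (suc n) = not (alternate x n)

alternate-double : ∀ x i → alternate x (i + i) ≡ x
alternate-double x zero    = refl
alternate-double x (suc i) rewrite +-suc i i = trans (not-involutive _) (alternate-double x i)

alternate-even : ∀ x {m n} j → m + n ≡ j + j → alternate x m ≡ alternate x n
alternate-odd  : ∀ x {m n} j → m + n ≡ suc (j + j) → alternate x m ≡ not (alternate x n)
alternate-even x {zero} j refl = sym (alternate-double x j)
alternate-even x {suc m} {n} (suc j) eq =
  trans (cong not (alternate-odd x {m} {n} j (suc-injective (trans eq (+-suc (suc j) j))))) (not-involutive _)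
alternate-odd x {zero} {suc n} j eq =
  sym (trans (not-involutive _) (alternate-even x {n} {zero} j (trans (+-identityʳ n) (suc-injective eq))))
alternate-odd x {suc m} {n} j eq = cong not (alternate-even x {m} {n} j (suc-injective eq))

alternate-not : ∀ x n → alternate (not x) n ≡ not (alternate x n)
alternate-not x zero    = refl
alternate-not x (suc n) = cong not (alternate-not x n)

zigzag : ℕ → ℕ → ℕ → ℕ
zigzag α β zero    = α
zigzag α β (suc n) = zigzag β (suc α) n

zigzag-step : ∀ α β n → zigzag α β n + zigzag α β (suc n) ≡ α + β + n
zigzag-step α β zero    = sym (+-identityʳ (α + β))
zigzag-step α β (suc n) = trans (zigzag-step β (suc α) n) (rearrange α β n)
  where
  rearrange : ∀ α β n → β + suc α + n ≡ α + β + suc n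
  rearrange = solve-∀

zigzag-even : ∀ α β i → zigzag α β (i + i) ≡ α + i
zigzag-even α β zero    = sym (+-identityʳ α)
zigzag-even α β (suc i) rewrite +-suc i i = trans (zigzag-even (suc α) (suc β) i) (sym (+-suc α i))

zigzag-odd : ∀ α β i → zigzag α β (suc (i + i)) ≡ β + i
zigzag-odd α β i = zigzag-even β (suc α) i

parity : ∀ n → (Σ ℕ λ i → n ≡ i + i) ⊎ (Σ ℕ λ i → n ≡ suc (i + i))
parity zero = inj₁ (0 , refl)
parity (suc n) with parity n
... | inj₁ (i , n≡2i)   = inj₂ (i , cong suc n≡2i)
... | inj₂ (i , n≡2i+1) = inj₁ (suc i , trans (cong suc n≡2i+1) (cong suc (sym (+-suc i i))))

half-≤ : ∀ {i h} → i + i ≤ suc (h + h) → i ≤ h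
half-≤ {zero} _ = z≤n
half-≤ {suc i} {zero} (s≤s 2i+1≤0) rewrite +-suc i i = contradiction 2i+1≤0 λ ()
half-≤ {suc i} {suc h} (s≤s le) rewrite +-suc i i | +-suc h h = s≤s (half-≤ (≤-pred le))

-- The circle ℤ_{2ℓ}

OneOrTwo : ℕ → Set
OneOrTwo n = n ≡ 1 ⊎ n ≡ 2

OneOrTwo-swap : ∀ a b c → OneOrTwo (a + b + c) → OneOrTwo (a + c + b)
OneOrTwo-swap a b c = subst OneOrTwo (lemma a b c)
  where
  lemma : ∀ a b c → a + b + c ≡ a + c + b
  lemma = solve-∀

OneOrTwo-reverse : ∀ a b c → OneOrTwo (a + b + c) → OneOrTwo (c + b + a)
OneOrTwo-reverse a b c = subst OneOrTwo (lemma a b c)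
  where
  lemma : ∀ a b c → a + b + c ≡ c + b + a
  lemma = solve-∀

nonconstant-sum : ∀ x y z → ¬ (x ≡ true × y ≡ true × z ≡ true) → ¬ (x ≡ false × y ≡ false × z ≡ false) →
  OneOrTwo (indicator x + indicator y + indicator z)
nonconstant-sum true  true  true  ¬red ¬blue = contradiction (refl , refl , refl) ¬red
nonconstant-sum true  true  false ¬red ¬blue = inj₂ refl
nonconstant-sum true  false true  ¬red ¬blue = inj₂ refl
nonconstant-sum true  false false ¬red ¬blue = inj₁ refl
nonconstant-sum false true  true  ¬red ¬blue = inj₂ refl
nonconstant-sum false true  false ¬red ¬blue = inj₁ refl
nonconstant-sum false false true  ¬red ¬blue = inj₁ refl
nonconstant-sum false false false ¬red ¬blue = contradiction (refl , refl , refl) ¬blue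

module Circle (l : ℕ) where

  ℓ N : ℕ
  ℓ = suc l
  N = ℓ + ℓ

  %-absorbˡ : ∀ a x → (a + x) % N ≡ (a % N + x) % N
  %-absorbˡ a x = begin
    (a + x) % N             ≡⟨ %-distribˡ-+ a x N ⟩
    (a % N + x % N) % N     ≡⟨ cong (λ r → (r + x % N) % N) (m%n%n≡m%n a N) ⟨
    (a % N % N + x % N) % N ≡⟨ %-distribˡ-+ (a % N) x N ⟨
    (a % N + x) % N         ∎
    where open ≡-Reasoning

  residue : ∀ {a} r n → a ≡ r + n * N → r < N → a % N ≡ r
  residue r n refl r<N = trans ([m+kn]%n≡m%n r n N) (m<n⇒m%n≡m r<N)

  residue-< : ∀ {v} w → v ≡ w → w < N → v % N ≡ w
  residue-< w refl w<N = m<n⇒m%n≡m w<N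

  <N-via : ∀ {r} b e → r ≤ b → b + suc e ≡ N → r < N
  <N-via {r} b e r≤b b+1+e≡N = ≤-<-trans r≤b (subst (b <_) b+1+e≡N (m<m+n b (s≤s z≤n)))

  ≡-mod : ∀ {x} y n → x ≡ y + n * N → x % N ≡ y % N
  ≡-mod y n refl = [m+kn]%n≡m%n y n N

  suc-residue : ∀ x → suc (x % N) < N → suc x % N ≡ suc (x % N)
  suc-residue x 1+r<N = begin
    suc x % N          ≡⟨ cong (_% N) (+-comm 1 x) ⟩
    (x + 1) % N        ≡⟨ %-absorbˡ x 1 ⟩
    (x % N + 1) % N    ≡⟨ cong (_% N) (+-comm (x % N) 1) ⟩
    suc (x % N) % N    ≡⟨ m<n⇒m%n≡m 1+r<N ⟩
    suc (x % N)        ∎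
    where open ≡-Reasoning

  ∸-exact : ∀ {a b} → b + a ≡ N → N ∸ a ≡ b
  ∸-exact {a} {b} b+a≡N = trans (cong (_∸ a) (sym b+a≡N)) (m+n∸n≡m b a)

  residue-∸ : ∀ {a} w → w + a ≡ N → 0 < a → (N ∸ a) % N ≡ w
  residue-∸ {a} w w+a≡N 0<a = trans (cong (_% N) (∸-exact {a} {w} w+a≡N)) (m<n⇒m%n≡m (subst (w <_) w+a≡N (m<m+n w 0<a)))

  wrap : ∀ a s → s ≤ N → (a + s + (N ∸ s)) % N ≡ a % N
  wrap a s s≤N = trans (cong (_% N) (trans (+-assoc a s (N ∸ s)) (cong (a +_) (m+[n∸m]≡n s≤N)))) ([m+n]%n≡m%n a N)

  negate : ℕ → ℕ
  negate σ = N ∸ σ % N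

  negate-cancel : ∀ σ x → (negate σ + (σ + x)) % N ≡ x % N
  negate-cancel σ x = begin
    (negate σ + (σ + x)) % N                          ≡⟨ cong (λ s → (negate σ + (s + x)) % N) (m≡m%n+[m/n]*n σ N) ⟩
    (negate σ + (σ % N + σ / N * N + x)) % N          ≡⟨ cong (_% N) (rearrange (negate σ) (σ % N) (σ / N * N) x) ⟩
    (x + (negate σ + σ % N) + σ / N * N) % N          ≡⟨ [m+kn]%n≡m%n (x + (negate σ + σ % N)) (σ / N) N ⟩
    (x + (negate σ + σ % N)) % N                      ≡⟨ cong (λ s → (x + s) % N) (m∸n+n≡m (m%n≤n σ N)) ⟩
    (x + N) % N                                       ≡⟨ [m+n]%n≡m%n x N ⟩
    x % N                                             ∎
    where
    open ≡-Reasoning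
    rearrange : ∀ m r s x → m + (r + s + x) ≡ x + (m + r) + s
    rearrange = solve-∀

  negate-sum : ∀ σ τ D → (σ + τ + D) % N ≡ 0 → (τ + D) % N ≡ negate σ % N
  negate-sum σ τ D σ+τ+D≡0 = begin
    (τ + D) % N                           ≡⟨ negate-cancel σ (τ + D) ⟨
    (negate σ + (σ + (τ + D))) % N        ≡⟨ cong (λ s → (negate σ + s) % N) (+-assoc σ τ D) ⟨
    (negate σ + (σ + τ + D)) % N          ≡⟨ %-distribˡ-+ (negate σ) (σ + τ + D) N ⟩
    (negate σ % N + (σ + τ + D) % N) % N  ≡⟨ cong (λ s → (negate σ % N + s) % N) σ+τ+D≡0 ⟩
    (negate σ % N + 0) % N                ≡⟨ cong (_% N) (+-identityʳ (negate σ % N)) ⟩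
    negate σ % N % N                      ≡⟨ m%n%n≡m%n (negate σ) N ⟩
    negate σ % N                          ∎
    where open ≡-Reasoning

  negate-exact : ∀ {σ r} → σ + r ≡ N → 0 < r → negate σ ≡ r
  negate-exact {σ} {r} σ+r≡N 0<r = begin
    N ∸ σ % N       ≡⟨ cong (N ∸_) (m<n⇒m%n≡m (subst (σ <_) σ+r≡N (m<m+n σ 0<r))) ⟩
    N ∸ σ           ≡⟨ cong (_∸ σ) (sym σ+r≡N) ⟩
    σ + r ∸ σ       ≡⟨ m+n∸m≡n σ r ⟩
    r               ∎
    where open ≡-Reasoning

  red : ℕ → Bool
  red s = s % N <ᵇ ℓ

  red⇒< : ∀ s → red s ≡ true → s % N < ℓ
  red⇒< s eq = <ᵇ⇒< (s % N) ℓ (subst T (sym eq) tt)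

  red-+ℓ : ∀ s → red (s + ℓ) ≡ not (red s)
  red-+ℓ s = trans (cong (_<ᵇ ℓ) (%-absorbˡ s ℓ)) (shift (s % N) (m%n<n s N))
    where
    shift : ∀ r → r < N → ((r + ℓ) % N <ᵇ ℓ) ≡ not (r <ᵇ ℓ)
    shift r r<N with r <? ℓ
    ... | yes r<ℓ rewrite m<n⇒m%n≡m (+-monoˡ-< ℓ r<ℓ) | dec-true (r <? ℓ) r<ℓ = dec-false ((r + ℓ) <? ℓ) (m+n≮n r ℓ)
    ... | no r≮ℓ with m≤n⇒∃[o]m+o≡n (≮⇒≥ r≮ℓ)
    ... | e , refl = begin
      ((ℓ + e + ℓ) % N <ᵇ ℓ) ≡⟨ cong (λ s → s % N <ᵇ ℓ) (+-comm (ℓ + e) ℓ) ⟩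
      ((ℓ + (ℓ + e)) % N <ᵇ ℓ) ≡⟨ cong (λ s → s % N <ᵇ ℓ) (trans (sym (+-assoc ℓ ℓ e)) (+-comm N e)) ⟩
      ((e + N) % N <ᵇ ℓ)     ≡⟨ cong (_<ᵇ ℓ) (trans ([m+n]%n≡m%n e N) (m<n⇒m%n≡m (<-≤-trans e<ℓ (m≤m+n ℓ ℓ)))) ⟩
      (e <ᵇ ℓ)               ≡⟨ dec-true (e <? ℓ) e<ℓ ⟩
      true                   ≡⟨ cong not (dec-false (ℓ + e <? ℓ) (m+n≮n e ℓ ∘ subst (_< ℓ) (+-comm ℓ e))) ⟨
      not (ℓ + e <ᵇ ℓ)       ∎
      where
      open ≡-Reasoning
      e<ℓ : e < ℓ
      e<ℓ = +-cancelˡ-< ℓ e ℓ r<N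

  red-cong : ∀ {s s′} t → s % N ≡ s′ % N → red (s + t) ≡ red (s′ + t)
  red-cong {s} {s′} t s≡s′ = cong (_<ᵇ ℓ) (begin
    (s + t) % N        ≡⟨ %-absorbˡ s t ⟩
    (s % N + t) % N    ≡⟨ cong (λ r → (r + t) % N) s≡s′ ⟩
    (s′ % N + t) % N   ≡⟨ %-absorbˡ s′ t ⟨
    (s′ + t) % N       ∎)
    where open ≡-Reasoning

  -- With r = a mod N < ℓ: either r+f+g < N, and then a+f+g is not red, or r+f+g ≥ N,
  -- and then a+f has residue r+f ∈ [ℓ, N).
  not-all-red : ∀ {f g} → f ≤ ℓ → g ≤ ℓ → ℓ ≤ f + g → ∀ a →
    red a ≡ true → red (a + f) ≡ true → red (a + f + g) ≡ true → ⊥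
  not-all-red {f} {g} f≤ℓ g≤ℓ ℓ≤f+g a ra rb rc with a % N + (f + g) <? N
  ... | yes r+f+g<N = <⇒≱ (red⇒< (a + f + g) rc) (begin
    ℓ                          ≤⟨ ℓ≤f+g ⟩
    f + g                      ≤⟨ m≤n+m (f + g) (a % N) ⟩
    a % N + (f + g)            ≡⟨ m<n⇒m%n≡m r+f+g<N ⟨
    (a % N + (f + g)) % N      ≡⟨ %-absorbˡ a (f + g) ⟨
    (a + (f + g)) % N          ≡⟨ cong (_% N) (+-assoc a f g) ⟨
    (a + f + g) % N            ∎)
    where open ≤-Reasoning
  ... | no r+f+g≮N = <⇒≱ (red⇒< (a + f) rb) (begin
    ℓ                          ≤⟨ +-cancelʳ-≤ g ℓ (a % N + f) (begin
      ℓ + g                      ≤⟨ +-monoʳ-≤ ℓ g≤ℓ ⟩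
      N                          ≤⟨ ≮⇒≥ r+f+g≮N ⟩
      a % N + (f + g)            ≡⟨ +-assoc (a % N) f g ⟨
      a % N + f + g              ∎) ⟩
    a % N + f                  ≡⟨ m<n⇒m%n≡m r+f<N ⟨
    (a % N + f) % N            ≡⟨ %-absorbˡ a f ⟨
    (a + f) % N                ∎)
    where
    open ≤-Reasoning
    r+f<N : a % N + f < N
    r+f<N = +-mono-<-≤ (red⇒< a ra) f≤ℓ

  three-points : ∀ {f g} → f ≤ ℓ → g ≤ ℓ → ℓ ≤ f + g → ∀ a →
    OneOrTwo (indicator (red a) + indicator (red (a + f)) + indicator (red (a + f + g)))
  three-points {f} {g} f≤ℓ g≤ℓ ℓ≤f+g a =
    nonconstant-sum (red a) (red (a + f)) (red (a + f + g))
      (λ (ra , rb , rc) → not-all-red f≤ℓ g≤ℓ ℓ≤f+g a ra rb rc)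
      (λ (ba , bb , bc) → not-all-red f≤ℓ g≤ℓ ℓ≤f+g (a + ℓ)
         (blue⇒red a ba) (shifted (a + f) bb (shift₁ a f)) (shifted (a + f + g) bc (shift₂ a f g)))
    where
    blue⇒red : ∀ s → red s ≡ false → red (s + ℓ) ≡ true
    blue⇒red s b = trans (red-+ℓ s) (cong not b)
    shifted : ∀ s {s′} → red s ≡ false → s + ℓ ≡ s′ → red s′ ≡ true
    shifted s b refl = blue⇒red s b
    shift₁ : ∀ a f → a + f + ℓ ≡ a + ℓ + f
    shift₁ = solve-∀
    shift₂ : ∀ a f g → a + f + g + ℓ ≡ a + ℓ + f + g
    shift₂ = solve-∀

  reds : Fin N → ℕ → ℕ
  reds t p = indicator (red (p + toℕ t))

  arc-balanced : ∀ {f g} → f ≤ ℓ → g ≤ ℓ → ℓ ≤ f + g → ∀ p₁ p₂ p₃ a →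
    p₁ % N ≡ a % N → p₂ % N ≡ (a + f) % N → p₃ % N ≡ (a + f + g) % N → ∀ t →
    OneOrTwo (indicator (red (p₁ + t)) + indicator (red (p₂ + t)) + indicator (red (p₃ + t)))
  arc-balanced {f} {g} f≤ℓ g≤ℓ ℓ≤f+g p₁ p₂ p₃ a p₁≡ p₂≡ p₃≡ t = subst OneOrTwo
    (cong₂ _+_ (cong₂ _+_
      (cong indicator (sym (red-cong {p₁} {a} t p₁≡)))
      (cong indicator (trans (cong red (xy∙z≈xz∙y a t f)) (sym (red-cong {p₂} {a + f} t p₂≡)))))
      (cong indicator (trans (cong red (shift a t f g)) (sym (red-cong {p₃} {a + f + g} t p₃≡)))))
    (three-points f≤ℓ g≤ℓ ℓ≤f+g (a + t))
    where
    shift : ∀ a t f g → a + t + f + g ≡ a + f + g + t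
    shift = solve-∀

  ⟨_⟩ : ℕ → Fin N
  ⟨ a ⟩ = fromℕ< (m%n<n a N)

  level : Bool → Fin 2
  level false = Fin.zero
  level true  = Fin.suc Fin.zero

  level-injective : ∀ {x x′} → level x ≡ level x′ → x ≡ x′
  level-injective {false} {false} _ = refl
  level-injective {true}  {true}  _ = refl
  level-injective {false} {true}  ()
  level-injective {true}  {false} ()

  vertex : ℕ → Bool → Vtx ℓ
  vertex a x = ⟨ a ⟩ , level x

  diffZ-residue : ∀ a b D → (a + D) % N ≡ b % N → diffZ ℓ ⟨ a ⟩ ⟨ b ⟩ ≡ D % N
  diffZ-residue a b D a+D≡b = begin
    (toℕ ⟨ b ⟩ + (N ∸ toℕ ⟨ a ⟩)) % N
      ≡⟨ cong₂ (λ s r → (s + (N ∸ r)) % N) (toℕ-fromℕ< (m%n<n b N)) (toℕ-fromℕ< (m%n<n a N)) ⟩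
    (b % N + negate a) % N
      ≡⟨ cong (λ s → (s + negate a) % N) a+D≡b ⟨
    ((a + D) % N + negate a) % N
      ≡⟨ %-absorbˡ (a + D) (negate a) ⟨
    (a + D + negate a) % N
      ≡⟨ cong (_% N) (rearrange a D (negate a)) ⟩
    (negate a + (a + D)) % N
      ≡⟨ negate-cancel a D ⟩
    D % N ∎
    where
    open ≡-Reasoning
    rearrange : ∀ a D m → a + D + m ≡ m + (a + D)
    rearrange = solve-∀

  mixed-up : ∀ a b D d → (a + D) % N ≡ b % N → isMixedWith ℓ d (vertex a false , vertex b true) ≡ (D % N ≡ᵇ d)
  mixed-up a b D d a+D≡b = cong (_≡ᵇ d) (diffZ-residue a b D a+D≡b)

  mixed-down : ∀ a b D d → (b + D) % N ≡ a % N → isMixedWith ℓ d (vertex a true , vertex b false) ≡ (D % N ≡ᵇ d)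
  mixed-down a b D d b+D≡a = cong (_≡ᵇ d) (diffZ-residue b a D b+D≡a)

  signed : Bool → ℕ → ℕ
  signed true  σ = σ
  signed false σ = negate σ

  mixed-signed : ∀ x σ τ d →
    isMixedWith ℓ d (vertex (signed x σ) x , vertex (signed (not x) τ) (not x)) ≡ ((σ + τ) % N ≡ᵇ d)
  mixed-signed false σ τ d = mixed-up (negate σ) τ (σ + τ) d (negate-cancel σ τ)
  mixed-signed true  σ τ d = mixed-down σ (negate τ) (σ + τ) d
    (trans (cong (λ s → (negate τ + s) % N) (+-comm σ τ)) (negate-cancel τ σ))

  mixed-mirror : ∀ x σ τ D d → (σ + τ + D) % N ≡ 0 →
    isMixedWith ℓ d (vertex (signed (not x) τ) (not (not x)) , vertex (signed x σ) (not x)) ≡ (D % N ≡ᵇ d)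
  mixed-mirror false σ τ D d σ+τ+D≡0 = mixed-up τ (negate σ) D d (negate-sum σ τ D σ+τ+D≡0)
  mixed-mirror true  σ τ D d σ+τ+D≡0 =
    mixed-down (negate τ) σ D d (negate-sum τ σ D (trans (cong (λ s → (s + D) % N) (+-comm τ σ)) σ+τ+D≡0))

  -- the three edges u → u+s → u+s+1 → u, whose first vertex is on level y
  middle₁ middle₃ : Bool → ℕ → ℕ
  middle₁ false s = s
  middle₁ true  s = N ∸ s
  middle₃ false s = N ∸ suc s
  middle₃ true  s = suc s

  middle₂ : Bool → ℕ
  middle₂ false = N ∸ 1
  middle₂ true  = 1

  middle-edge₁ : ∀ y a s d → s ≤ N → isMixedWith ℓ d (vertex a y , vertex (a + s) (not y)) ≡ (middle₁ y s % N ≡ᵇ d)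
  middle-edge₁ false a s d _   = mixed-up a (a + s) s d refl
  middle-edge₁ true  a s d s≤N = mixed-down a (a + s) (N ∸ s) d (wrap a s s≤N)

  middle-edge₂ : ∀ y a d → isMixedWith ℓ d (vertex a (not y) , vertex (suc a) (not (not y))) ≡ (middle₂ y % N ≡ᵇ d)
  middle-edge₂ false a d = mixed-down a (suc a) (N ∸ 1) d (trans (cong (λ s → (s + (N ∸ 1)) % N) (+-comm 1 a)) (wrap a 1 (s≤s z≤n)))
  middle-edge₂ true  a d = mixed-up a (suc a) 1 d (cong (_% N) (+-comm a 1))

  middle-edge₃ : ∀ y a s d → suc s ≤ N →
    isMixedWith ℓ d (vertex (suc (a + s)) (not (not y)) , vertex a (not y)) ≡ (middle₃ y s % N ≡ᵇ d)
  middle-edge₃ false a s d s<N = mixed-up (suc (a + s)) a (N ∸ suc s) d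
    (trans (cong (λ r → (r + (N ∸ suc s)) % N) (sym (+-suc a s))) (wrap a (suc s) s<N))
  middle-edge₃ true  a s d _   = mixed-down (suc (a + s)) a (suc s) d (cong (_% N) (+-suc a s))

  isMixed-level : ∀ a b x → isMixed ℓ (vertex a x , vertex b (not x)) ≡ true
  isMixed-level a b false = refl
  isMixed-level a b true  = refl

  isPure-level : ∀ i m a b x → isPureWith ℓ i m (vertex a x , vertex b (not x)) ≡ false
  isPure-level Fin.zero           m a b false = refl
  isPure-level Fin.zero           m a b true  = refl
  isPure-level (Fin.suc Fin.zero) m a b false = refl
  isPure-level (Fin.suc Fin.zero) m a b true  = refl

  isMixedWith-same-level : ∀ d a b x → isMixedWith ℓ d (vertex a x , vertex b x) ≡ false
  isMixedWith-same-level d a b false = refl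
  isMixedWith-same-level d a b true  = refl

  isPure-same-level : ∀ x a b m → (a + (N ∸ m)) % N ≡ b % N → isPureWith ℓ (level x) m (vertex a x , vertex b x) ≡ true
  isPure-same-level x a b m a+D≡b = begin
    isPureWith ℓ (level x) m (vertex a x , vertex b x)
      ≡⟨ same-level x ⟩
    (diffZ ℓ ⟨ a ⟩ ⟨ b ⟩ ≡ᵇ m % N) ∨ (diffZ ℓ ⟨ a ⟩ ⟨ b ⟩ ≡ᵇ (N ∸ m) % N)
      ≡⟨ cong (λ e → (e ≡ᵇ m % N) ∨ (e ≡ᵇ (N ∸ m) % N)) (diffZ-residue a b (N ∸ m) a+D≡b) ⟩
    ((N ∸ m) % N ≡ᵇ m % N) ∨ ((N ∸ m) % N ≡ᵇ (N ∸ m) % N)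
      ≡⟨ cong (((N ∸ m) % N ≡ᵇ m % N) ∨_) (dec-true ((N ∸ m) % N ≟ (N ∸ m) % N) refl) ⟩
    ((N ∸ m) % N ≡ᵇ m % N) ∨ true
      ≡⟨ ∨-zeroʳ _ ⟩
    true ∎
    where
    open ≡-Reasoning
    same-level : ∀ x → isPureWith ℓ (level x) m (vertex a x , vertex b x)
      ≡ ((diffZ ℓ ⟨ a ⟩ ⟨ b ⟩ ≡ᵇ m % N) ∨ (diffZ ℓ ⟨ a ⟩ ⟨ b ⟩ ≡ᵇ (N ∸ m) % N))
    same-level false = refl
    same-level true  = refl

  indicator-residue : ∀ v {w} d → v % N ≡ w → indicator (v % N ≡ᵇ d) ≡ window w 1 d
  indicator-residue v {w} d v≡w = trans (cong (λ r → indicator (r ≡ᵇ d)) v≡w) (sym (window-single w d))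

  isRed-flip : ∀ c x → isRed ℓ (c , level (not x)) ≡ not (isRed ℓ (c , level x))
  isRed-flip c false = refl
  isRed-flip c true  = sym (not-involutive _)

  -- a translate of a vertex is red exactly when the translate of its shade lies in [0, ℓ) mod N
  shade : ℕ → Bool → ℕ
  shade a false = a
  shade a true  = a + ℓ

  residue-+ : ∀ a t → toℕ (addZ ℓ ⟨ a ⟩ t) ≡ (a + toℕ t) % N
  residue-+ a t = begin
    toℕ (addZ ℓ ⟨ a ⟩ t)      ≡⟨ toℕ-fromℕ< _ ⟩
    (toℕ ⟨ a ⟩ + toℕ t) % N   ≡⟨ cong (λ s → (s + toℕ t) % N) (toℕ-fromℕ< (m%n<n a N)) ⟩
    (a % N + toℕ t) % N       ≡⟨ %-absorbˡ a (toℕ t) ⟨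
    (a + toℕ t) % N           ∎
    where open ≡-Reasoning

  isRed-translate : ∀ a x t → isRed ℓ (addZ ℓ ⟨ a ⟩ t , level x) ≡ red (shade a x + toℕ t)
  isRed-translate a false t = cong (_<ᵇ ℓ) (residue-+ a t)
  isRed-translate a true t = begin
    not (toℕ (addZ ℓ ⟨ a ⟩ t) <ᵇ ℓ) ≡⟨ cong (λ s → not (s <ᵇ ℓ)) (residue-+ a t) ⟩
    not (red (a + toℕ t))           ≡⟨ red-+ℓ (a + toℕ t) ⟨
    red (a + toℕ t + ℓ)             ≡⟨ cong red (xy∙z≈xz∙y a (toℕ t) ℓ) ⟩
    red (a + ℓ + toℕ t)             ∎
    where open ≡-Reasoning

-- Mirrored zigzag cycles

-- Identities in q live outside Construction: inside it the ring solver cannot see through k, ℓ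
-- and N, and q cannot be instantiated by pattern matching.
private
  k+1<N : ∀ q → suc (3 + q) + suc (9 + 3 * q) ≡ suc (2 * (3 + q)) + suc (2 * (3 + q))
  k+1<N = solve-∀
  k+2<N : ∀ q → 2 + (3 + q) + suc (8 + 3 * q) ≡ suc (2 * (3 + q)) + suc (2 * (3 + q))
  k+2<N = solve-∀
  1<N : ∀ q → 1 + suc (12 + 4 * q) ≡ suc (2 * (3 + q)) + suc (2 * (3 + q))
  1<N = solve-∀
  3k<N : ∀ q → 3 * (3 + q) + suc (4 + q) ≡ suc (2 * (3 + q)) + suc (2 * (3 + q))
  3k<N = solve-∀
  4k+2≡N : ∀ q → 4 * (3 + q) + 1 + 1 ≡ suc (2 * (3 + q)) + suc (2 * (3 + q))
  4k+2≡N = solve-∀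
  3k+k+2≡N : ∀ q → 3 * (3 + q) + suc (suc (3 + q)) ≡ suc (2 * (3 + q)) + suc (2 * (3 + q))
  3k+k+2≡N = solve-∀
  k+2+3k≡N : ∀ q → 2 + (3 + q) + 3 * (3 + q) ≡ suc (2 * (3 + q)) + suc (2 * (3 + q))
  k+2+3k≡N = solve-∀
  3k+1+k+1≡N : ∀ q → 3 * (3 + q) + 1 + suc (3 + q) ≡ suc (2 * (3 + q)) + suc (2 * (3 + q))
  3k+1+k+1≡N = solve-∀
  k+1+3k+1≡N : ∀ q → suc (3 + q) + suc (3 * (3 + q)) ≡ suc (2 * (3 + q)) + suc (2 * (3 + q))
  k+1+3k+1≡N = solve-∀

  down-value₀ : ∀ {q} i e → i + i + e ≡ q → 3 * (3 + q) + 4 + i + suc (i + e) ≡ suc (2 * (3 + q)) + suc (2 * (3 + q))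
  down-value₀ i e refl = lemma i e
    where
    lemma : ∀ i e → 3 * (3 + (i + i + e)) + 4 + i + suc (i + e) ≡ suc (2 * (3 + (i + i + e))) + suc (2 * (3 + (i + i + e)))
    lemma = solve-∀
  down-bound₀ : ∀ {q} i e → i + i + e ≡ q → suc (i + e) < 3 + q
  down-bound₀ i e refl = <-by (suc i) (lemma i e)
    where
    lemma : ∀ i e → suc (i + e) + suc (suc i) ≡ 3 + (i + i + e)
    lemma = solve-∀
  down-index₀ : ∀ {q} i e → i + i + e ≡ q → 2 * (3 + q ∸ suc (suc (i + e))) ≡ suc (suc (i + i))
  down-index₀ i e refl = trans (cong (2 *_) (trans (cong (_∸ (2 + (i + e))) (lemma i e)) (m+n∸n≡m (suc i) (2 + (i + e))))) (lemma′ i)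
    where
    lemma : ∀ i e → 3 + (i + i + e) ≡ suc i + (2 + (i + e))
    lemma = solve-∀
    lemma′ : ∀ i → 2 * suc i ≡ suc (suc (i + i))
    lemma′ = solve-∀

  up-value₁ : ∀ {q′} i e → i + i + e ≡ q′ → 2 * (2 + q′) + 2 + i + (4 + 3 * i + 2 * e) ≡ suc (2 * (2 + q′)) + suc (2 * (2 + q′))
  up-value₁ i e refl = lemma i e
    where
    lemma : ∀ i e → 2 * (2 + (i + i + e)) + 2 + i + (4 + 3 * i + 2 * e) ≡ suc (2 * (2 + (i + i + e))) + suc (2 * (2 + (i + i + e)))
    lemma = solve-∀
  up-above₁ : ∀ {q′} i e → i + i + e ≡ q′ → 2 + q′ < 4 + 3 * i + 2 * e
  up-above₁ i e refl = <-by (suc (i + e)) (lemma i e)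
    where
    lemma : ∀ i e → 2 + (i + i + e) + suc (suc (i + e)) ≡ 4 + 3 * i + 2 * e
    lemma = solve-∀
  up-twice₁ : ∀ {q′} i e → i + i + e ≡ q′ → 2 * (2 + q′) ≡ (4 + 3 * i + 2 * e) + i
  up-twice₁ i e refl = lemma i e
    where
    lemma : ∀ i e → 2 * (2 + (i + i + e)) ≡ (4 + 3 * i + 2 * e) + i
    lemma = solve-∀
  up-below₁ : ∀ {q′} i e → i + i + e ≡ q′ → 4 + 3 * i + 2 * e ≤ 2 * (2 + q′)
  up-below₁ i e 2i+e≡q′ = ≤-by i (sym (up-twice₁ i e 2i+e≡q′))

module Construction (q : ℕ) where

  k : ℕ
  k = 3 + q

  open Circle (2 * k) public

  mirror-sum : ∀ {Z W} → Z + W ≡ suc q → suc Z + (2 + k + W) ≡ ℓ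
  mirror-sum {Z} {W} Z+W≡ = trans (regroup Z W k) (trans (cong (λ n → 3 + k + n) Z+W≡) (total q))
    where
    regroup : ∀ Z W k → suc Z + (2 + k + W) ≡ 3 + k + (Z + W)
    regroup = solve-∀
    total : ∀ q → 3 + (3 + q) + suc q ≡ suc (2 * (3 + q))
    total = solve-∀

  -- positions 0 … k+1 are the first half of the cycle; position ℓ - Z mirrors position Z
  fold : ℕ → ℕ
  fold Y = if Y <ᵇ 2 + k then Y else ℓ ∸ Y

  fold-half : ∀ {Y} → Y < 2 + k → fold Y ≡ Y
  fold-half {Y} Y<2+k = if-true (dec-true (Y <? 2 + k) Y<2+k)

  fold-mirror : ∀ {Z W} → Z + W ≡ suc q → fold (2 + k + W) ≡ suc Z
  fold-mirror {Z} {W} Z+W≡ = begin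
    fold (2 + k + W) ≡⟨ if-false (dec-false (2 + k + W <? 2 + k) (m+n≮m (2 + k) W)) ⟩
    ℓ ∸ (2 + k + W)  ≡⟨ cong (_∸ (2 + k + W)) (mirror-sum {Z} {W} Z+W≡) ⟨
    suc Z + (2 + k + W) ∸ (2 + k + W) ≡⟨ m+n∸n≡m (suc Z) (2 + k + W) ⟩
    suc Z ∎
    where open ≡-Reasoning

  fold-upper : ∀ {Y} → ¬ Y < 2 + k → fold Y ≡ ℓ ∸ Y
  fold-upper {Y} Y≮2+k = if-false (dec-false (Y <? 2 + k) Y≮2+k)

  fold-bound : ∀ {Y} → Y < ℓ → fold Y < 2 + k
  fold-bound {Y} Y<ℓ with Y <? 2 + k
  ... | yes Y<2+k = subst (_< 2 + k) (sym (fold-half Y<2+k)) Y<2+k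
  ... | no Y≮2+k = subst (_< 2 + k) (sym (fold-upper Y≮2+k)) (begin-strict
    ℓ ∸ Y             ≤⟨ ∸-monoʳ-≤ ℓ (≮⇒≥ Y≮2+k) ⟩
    ℓ ∸ (2 + k)       ≡⟨ cong (_∸ (2 + k)) (halves q) ⟩
    (2 + q) + (2 + k) ∸ (2 + k) ≡⟨ m+n∸n≡m (2 + q) (2 + k) ⟩
    2 + q             <⟨ m<n+m (2 + q) {3} (s≤s z≤n) ⟩
    2 + k             ∎)
    where
    open ≤-Reasoning
    halves : ∀ q → suc (2 * (3 + q)) ≡ (2 + q) + (2 + (3 + q))
    halves = solve-∀

  -- the fold indices 0 … k+1: the start, the two strands of the zigzag, and the two centre positions
  data Section : ℕ → Set where
    start : Section 0
    up    : ∀ i → i + i < 2 + q → Section (suc (i + i))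
    down  : ∀ i → suc (i + i) < 2 + q → Section (suc (suc (i + i)))
    mid   : Section k
    mid′  : Section (suc k)

  section : ∀ {Z} → Z < 2 + k → Section Z
  section {zero} _ = start
  section {suc Z} Z<2+k with Z <? 2 + q
  ... | yes Z<2+q with parity Z
  ...   | inj₁ (i , refl) = up i Z<2+q
  ...   | inj₂ (i , refl) = down i Z<2+q
  section {suc Z} Z<2+k | no Z≮2+q with Z ≟ 2 + q
  ...   | yes refl = mid
  ...   | no Z≢2+q = subst (Section ∘ suc) Z≡3+q mid′
    where
    Z≡3+q : 3 + q ≡ Z
    Z≡3+q = ≤-antisym (≤∧≢⇒< (≮⇒≥ Z≮2+q) (Z≢2+q ∘ sym)) (≤-pred (≤-pred Z<2+k))

  residue-shift : ∀ {A c} n → A ≡ c + n * N → c + q < N → ∀ Z → Z < suc q → (A + Z) % N ≡ c + Z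
  residue-shift {A} {c} n A≡ c+q<N Z Z<1+q = residue (c + Z) n (trans (cong (_+ Z) A≡) (rearrange c (n * N) Z))
    (≤-<-trans (+-monoʳ-≤ c (≤-pred Z<1+q)) c+q<N)
    where
    rearrange : ∀ c m Z → c + m + Z ≡ c + Z + m
    rearrange = solve-∀

  residue-sum : ∀ {A c} W → W < suc q → A + c + q ≡ 2 * N → (A + (q ∸ W) + (c + W)) % N ≡ 0
  residue-sum {A} {c} W W<1+q A+c+q≡ = residue 0 2 (begin
    A + (q ∸ W) + (c + W)   ≡⟨ regroup A (q ∸ W) c W ⟩
    A + c + (q ∸ W + W)     ≡⟨ cong (A + c +_) (m∸n+n≡m (≤-pred W<1+q)) ⟩
    A + c + q               ≡⟨ A+c+q≡ ⟩
    2 * N                   ∎) (s≤s z≤n)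
    where
    open ≡-Reasoning
    regroup : ∀ A r c W → A + r + (c + W) ≡ A + c + (r + W)
    regroup = solve-∀

  -- Position 0 has level x₀ and signed value σ₀, positions 1 … k-1 have the signed values
  -- α, β, α+1, β+1, …, positions k and k+1 carry the values u+s and u+s+1 for the value u at
  -- position k-1, and positions k+2 … 2k mirror positions k-1 … 1.
  module Mirrored (x₀ : Bool) (σ₀ α β s : ℕ) where

    levelAt : ℕ → Bool
    levelAt = alternate x₀

    front : ℕ → ℕ
    front Z = signed (levelAt (suc Z)) (zigzag α β Z)

    u : ℕ
    u = front (suc q)

    value : ℕ → ℕ
    value zero    = signed x₀ σ₀
    value (suc Z) = if Z <ᵇ 2 + q then front Z else if Z ≡ᵇ 2 + q then u + s else suc (u + s)

    position : ℕ → Vtx ℓ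
    position Y = vertex (value (fold Y)) (levelAt Y)

    level-complement : ∀ Y Z → Y + Z ≡ ℓ → levelAt Y ≡ not (levelAt Z)
    level-complement Y Z Y+Z≡ℓ = alternate-odd x₀ {Y} {Z} k (trans Y+Z≡ℓ (cong (λ n → suc (k + n)) (+-identityʳ k)))

    level-mirror : ∀ {Z W} → Z + W ≡ suc q → levelAt (2 + k + W) ≡ not (levelAt (suc Z))
    level-mirror {Z} {W} Z+W≡ = level-complement (2 + k + W) (suc Z) (trans (+-comm (2 + k + W) (suc Z)) (mirror-sum {Z} {W} Z+W≡))

    value-front : ∀ {Z} → Z < 2 + q → value (suc Z) ≡ front Z
    value-front {Z} Z<2+q = if-true (dec-true (Z <? 2 + q) Z<2+q)

    position-front : ∀ {Z} → Z < 2 + q → position (suc Z) ≡ vertex (front Z) (levelAt (suc Z))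
    position-front {Z} Z<2+q = cong (λ a → vertex a (levelAt (suc Z)))
      (trans (cong value (fold-half (s≤s (m≤n⇒m≤o+n 2 Z<2+q)))) (value-front Z<2+q))

    front-up : ∀ i → front (i + i) ≡ signed (not x₀) (α + i)
    front-up i = cong₂ signed (cong not (alternate-double x₀ i)) (zigzag-even α β i)

    front-down : ∀ i → front (suc (i + i)) ≡ signed x₀ (β + i)
    front-down i = cong₂ signed (trans (not-involutive _) (alternate-double x₀ i)) (zigzag-odd α β i)

    value-up : ∀ i → i + i < 2 + q → value (suc (i + i)) ≡ signed (not x₀) (α + i)
    value-up i 2i<2+q = trans (value-front 2i<2+q) (front-up i)

    value-down : ∀ i → suc (i + i) < 2 + q → value (suc (suc (i + i))) ≡ signed x₀ (β + i)
    value-down i 2i+1<2+q = trans (value-front 2i+1<2+q) (front-down i)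

    value-k : value k ≡ u + s
    value-k = trans (if-false (dec-false (2 + q <? 2 + q) (n≮n _))) (if-true (dec-true (2 + q ≟ 2 + q) refl))

    value-suc-k : value (suc k) ≡ suc (u + s)
    value-suc-k = trans (if-false (dec-false (3 + q <? 2 + q) (≤⇒≯ (n≤1+n _)))) (if-false (dec-false (3 + q ≟ 2 + q) 1+n≢n))

    position-k : position k ≡ vertex (u + s) (levelAt k)
    position-k = cong (λ a → vertex a (levelAt k)) (trans (cong value (fold-half (m<n+m k {2} (s≤s z≤n)))) value-k)

    position-suc-k : position (suc k) ≡ vertex (suc (u + s)) (levelAt (suc k))
    position-suc-k = cong (λ a → vertex a (levelAt (suc k))) (trans (cong value (fold-half (n<1+n (suc k)))) value-suc-k)

    position-back : ∀ {Z W} → Z + W ≡ suc q → position (2 + k + W) ≡ vertex (front Z) (not (levelAt (suc Z)))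
    position-back {Z} {W} Z+W≡ = cong₂ vertex
      (trans (cong value (fold-mirror {Z} {W} Z+W≡)) (value-front (s≤s (subst (Z ≤_) Z+W≡ (m≤m+n Z W)))))
      (level-mirror {Z} {W} Z+W≡)

    hit : ℕ → ℕ → Bool
    hit d Y = isMixedWith ℓ d (position Y , position (suc Y))

    hit-start : ∀ d → hit d 0 ≡ ((σ₀ + α) % N ≡ᵇ d)
    hit-start d = trans (cong (λ p → isMixedWith ℓ d (position 0 , p)) (position-front {0} (s≤s z≤n)))
      (mixed-signed x₀ σ₀ α d)

    hit-front : ∀ d {Z} → Z < suc q → hit d (suc Z) ≡ ((α + β + Z) % N ≡ᵇ d)
    hit-front d {Z} Z<1+q = begin
      hit d (suc Z)
        ≡⟨ cong₂ (λ p p′ → isMixedWith ℓ d (p , p′)) (position-front (m≤n⇒m≤1+n Z<1+q)) (position-front (s≤s Z<1+q)) ⟩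
      isMixedWith ℓ d (vertex (front Z) (levelAt (suc Z)) , vertex (front (suc Z)) (levelAt (suc (suc Z))))
        ≡⟨ mixed-signed (levelAt (suc Z)) (zigzag α β Z) (zigzag α β (suc Z)) d ⟩
      ((zigzag α β Z + zigzag α β (suc Z)) % N ≡ᵇ d)
        ≡⟨ cong (λ n → n % N ≡ᵇ d) (zigzag-step α β Z) ⟩
      ((α + β + Z) % N ≡ᵇ d) ∎
      where open ≡-Reasoning

    hit-back : ∀ d {Z W} D → Z + W ≡ q → (α + β + Z + D) % N ≡ 0 → hit d (2 + k + W) ≡ (D % N ≡ᵇ d)
    hit-back d {Z} {W} D Z+W≡ sum≡0 = begin
      hit d (2 + k + W)
        ≡⟨ cong₂ (λ p p′ → isMixedWith ℓ d (p , p′))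
             (position-back {suc Z} {W} (cong suc Z+W≡))
             (trans (cong position (sym (+-suc (2 + k) W))) (position-back {Z} {suc W} (trans (+-suc Z W) (cong suc Z+W≡)))) ⟩
      isMixedWith ℓ d (vertex (front (suc Z)) (not (levelAt (suc (suc Z)))) , vertex (front Z) (not (levelAt (suc Z))))
        ≡⟨ mixed-mirror (levelAt (suc Z)) (zigzag α β Z) (zigzag α β (suc Z)) D d
             (trans (cong (λ n → (n + D) % N) (zigzag-step α β Z)) sum≡0) ⟩
      (D % N ≡ᵇ d) ∎
      where open ≡-Reasoning

    y : Bool
    y = levelAt (2 + q)

    hit-middle₁ : ∀ d → s ≤ N → hit d (2 + q) ≡ (middle₁ y s % N ≡ᵇ d)
    hit-middle₁ d s≤N = trans (cong₂ (λ p p′ → isMixedWith ℓ d (p , p′)) (position-front {suc q} ≤-refl) position-k)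
      (middle-edge₁ y u s d s≤N)

    hit-middle₂ : ∀ d → hit d k ≡ (middle₂ y % N ≡ᵇ d)
    hit-middle₂ d = trans (cong₂ (λ p p′ → isMixedWith ℓ d (p , p′)) position-k position-suc-k)
      (middle-edge₂ y (u + s) d)

    hit-middle₃ : ∀ d → suc s ≤ N → hit d (suc k) ≡ (middle₃ y s % N ≡ᵇ d)
    hit-middle₃ d s<N = trans (cong₂ (λ p p′ → isMixedWith ℓ d (p , p′)) position-suc-k
        (trans (cong position (sym (+-identityʳ (2 + k)))) (position-back {suc q} {0} (+-identityʳ (suc q)))))
      (middle-edge₃ y u s d s<N)

    hits-by-section : ∀ d → count (2 * k) (hit d) ≡
      indicator (hit d 0) + count (suc q) (λ Z → hit d (suc Z))
      + (indicator (hit d (2 + q)) + indicator (hit d k) + indicator (hit d (suc k)))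
      + count (suc q) (λ W → hit d (2 + k + W))
    hits-by-section d = begin
      count (2 * k) (hit d)
        ≡⟨ cong (λ n → count n (hit d)) (sections q) ⟩
      I 0 + count (suc q + (3 + suc q)) (hit d ∘ suc)
        ≡⟨ cong (I 0 +_) (count-+ (suc q) (3 + suc q) (hit d ∘ suc)) ⟩
      I 0 + (F + count (3 + suc q) (λ x → hit d (suc (suc q + x))))
        ≡⟨ cong (λ n → I 0 + (F + n)) centre-and-back ⟩
      I 0 + (F + (I (2 + q) + (I k + (I (suc k) + B))))
        ≡⟨ regroup (I 0) F (I (2 + q)) (I k) (I (suc k)) B ⟩
      I 0 + F + (I (2 + q) + I k + I (suc k)) + B ∎
      where
      open ≡-Reasoning
      I : ℕ → ℕ
      I Y = indicator (hit d Y)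
      F B : ℕ
      F = count (suc q) (λ Z → hit d (suc Z))
      B = count (suc q) (λ W → hit d (2 + k + W))
      sections : ∀ q → 2 * (3 + q) ≡ 1 + (suc q + (3 + suc q))
      sections = solve-∀
      regroup : ∀ a b c e f g → a + (b + (c + (e + (f + g)))) ≡ a + b + (c + e + f) + g
      regroup = solve-∀
      shift : ∀ q W → suc (suc q + (3 + W)) ≡ 2 + (3 + q) + W
      shift = solve-∀
      centre-and-back : count (3 + suc q) (λ x → hit d (suc (suc q + x))) ≡ I (2 + q) + (I k + (I (suc k) + B))
      centre-and-back = cong₂ _+_ (cong (I ∘ suc) (+-identityʳ (suc q)))
        (cong₂ _+_ (cong (I ∘ suc) (+-comm (suc q) 1))
        (cong₂ _+_ (cong (I ∘ suc) (+-comm (suc q) 2))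
          (count-cong (suc q) (λ W _ → cong (hit d) (shift q W)))))

    hits-by-window : ∀ d {e c c′} → s < N →
      (σ₀ + α) % N ≡ e →
      (∀ Z → Z < suc q → (α + β + Z) % N ≡ c + Z) →
      (∀ W → W < suc q → (α + β + (q ∸ W) + (c′ + W)) % N ≡ 0) →
      (∀ W → W < suc q → (c′ + W) % N ≡ c′ + W) →
      count (2 * k) (hit d) ≡
        window e 1 d + window c (suc q) d
        + (indicator (middle₁ y s % N ≡ᵇ d) + indicator (middle₂ y % N ≡ᵇ d) + indicator (middle₃ y s % N ≡ᵇ d))
        + window c′ (suc q) d
    hits-by-window d {e} {c} {c′} s<N start-diff front-diff back-sum back-diff = begin
      count (2 * k) (hit d)
        ≡⟨ hits-by-section d ⟩
      indicator (hit d 0) + count (suc q) (λ Z → hit d (suc Z))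
      + (indicator (hit d (2 + q)) + indicator (hit d k) + indicator (hit d (suc k)))
      + count (suc q) (λ W → hit d (2 + k + W))
        ≡⟨ cong₂ _+_ (cong₂ _+_ (cong₂ _+_ start-hits front-hits) middle-hits) back-hits ⟩
      window e 1 d + window c (suc q) d
      + (indicator (middle₁ y s % N ≡ᵇ d) + indicator (middle₂ y % N ≡ᵇ d) + indicator (middle₃ y s % N ≡ᵇ d))
      + window c′ (suc q) d ∎
      where
      open ≡-Reasoning
      start-hits : indicator (hit d 0) ≡ window e 1 d
      start-hits = trans (cong indicator (trans (hit-start d) (cong (_≡ᵇ d) start-diff))) (sym (window-single e d))
      front-hits : count (suc q) (λ Z → hit d (suc Z)) ≡ window c (suc q) d
      front-hits = count-cong (suc q) (λ Z Z<1+q → trans (hit-front d Z<1+q) (cong (_≡ᵇ d) (front-diff Z Z<1+q)))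
      middle-hits : indicator (hit d (2 + q)) + indicator (hit d k) + indicator (hit d (suc k))
        ≡ indicator (middle₁ y s % N ≡ᵇ d) + indicator (middle₂ y % N ≡ᵇ d) + indicator (middle₃ y s % N ≡ᵇ d)
      middle-hits = cong₂ _+_ (cong₂ _+_ (cong indicator (hit-middle₁ d (<⇒≤ s<N))) (cong indicator (hit-middle₂ d)))
        (cong indicator (hit-middle₃ d s<N))
      back-hits : count (suc q) (λ W → hit d (2 + k + W)) ≡ window c′ (suc q) d
      back-hits = count-cong (suc q) (λ W W<1+q →
        trans (hit-back d {q ∸ W} {W} (c′ + W) (m∸n+n≡m (≤-pred W<1+q)) (back-sum W W<1+q))
              (cong (_≡ᵇ d) (back-diff W W<1+q)))

    fold-complement : ∀ {Y Y′} → Y′ < ℓ → Y < 2 + k → ¬ Y′ < 2 + k → fold Y ≡ fold Y′ → Y′ + Y ≡ ℓ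
    fold-complement {Y} {Y′} Y′<ℓ Y< Y′≮ same =
      trans (cong (Y′ +_) (trans (sym (fold-half Y<)) (trans same (fold-upper Y′≮)))) (m+[n∸m]≡n (<⇒≤ Y′<ℓ))

    levels-differ : ∀ Y Y′ → Y′ + Y ≡ ℓ → levelAt Y ≢ levelAt Y′
    levels-differ Y Y′ Y′+Y≡ℓ same = not-¬ refl (trans same (level-complement Y′ Y Y′+Y≡ℓ))

    -- the two positions folding onto the same index lie on different levels
    fold-injective : ∀ {Y Y′} → Y < ℓ → Y′ < ℓ → fold Y ≡ fold Y′ → levelAt Y ≡ levelAt Y′ → Y ≡ Y′
    fold-injective {Y} {Y′} Y<ℓ Y′<ℓ same lev with Y <? 2 + k | Y′ <? 2 + k
    ... | yes Y< | yes Y′< = trans (sym (fold-half Y<)) (trans same (fold-half Y′<))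
    ... | yes Y< | no Y′≮  = contradiction lev (levels-differ Y Y′ (fold-complement Y′<ℓ Y< Y′≮ same))
    ... | no Y≮  | yes Y′< = contradiction (sym lev) (levels-differ Y′ Y (fold-complement Y<ℓ Y′< Y≮ (sym same)))
    ... | no Y≮  | no Y′≮  = ∸-cancelˡ-≡ (<⇒≤ Y<ℓ) (<⇒≤ Y′<ℓ) (trans (sym (fold-upper Y≮)) (trans same (fold-upper Y′≮)))

    ValueInjective : Set
    ValueInjective = ∀ {Z Z′} → Z < 2 + k → Z′ < 2 + k → value Z % N ≡ value Z′ % N → Z ≡ Z′

    position-injective : ValueInjective → ∀ {Y Y′} → Y < ℓ → Y′ < ℓ → position Y ≡ position Y′ → Y ≡ Y′
    position-injective value-injective {Y} {Y′} Y<ℓ Y′<ℓ same =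
      fold-injective Y<ℓ Y′<ℓ
        (value-injective (fold-bound Y<ℓ) (fold-bound Y′<ℓ)
          (trans (sym (toℕ-fromℕ< _)) (trans (cong (toℕ ∘ proj₁) same) (toℕ-fromℕ< _))))
        (level-injective (cong proj₂ same))

    cycle : ValueInjective → Cycle ℓ (2 * k)
    cycle value-injective = record
      { vs  = position ∘ toℕ
      ; inj = λ same → toℕ-injective (position-injective value-injective (toℕ<n _) (toℕ<n _) same)
      }

    redAt : Fin N → ℕ → Bool
    redAt t Y = isRed ℓ (addZ ℓ (proj₁ (position Y)) t , proj₂ (position Y))

    red-mirror : ∀ t {Z W} → Z + W ≡ suc q → redAt t (2 + k + W) ≡ not (redAt t (suc Z))
    red-mirror t {Z} {W} Z+W≡ = begin
      redAt t (2 + k + W)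
        ≡⟨ cong (λ p → isRed ℓ (addZ ℓ (proj₁ p) t , proj₂ p)) (position-back Z+W≡) ⟩
      isRed ℓ (addZ ℓ ⟨ front Z ⟩ t , level (not (levelAt (suc Z))))
        ≡⟨ isRed-flip (addZ ℓ ⟨ front Z ⟩ t) (levelAt (suc Z)) ⟩
      not (isRed ℓ (addZ ℓ ⟨ front Z ⟩ t , level (levelAt (suc Z))))
        ≡⟨ cong (λ p → not (isRed ℓ (addZ ℓ (proj₁ p) t , proj₂ p))) (position-front (s≤s (subst (Z ≤_) Z+W≡ (m≤m+n Z W)))) ⟨
      not (redAt t (suc Z)) ∎
      where open ≡-Reasoning

    redTriple : Fin N → ℕ
    redTriple t = indicator (redAt t 0) + indicator (redAt t k) + indicator (redAt t (suc k))

    redAt-vertex : ∀ t {Y a x} → position Y ≡ vertex a x → redAt t Y ≡ red (shade a x + toℕ t)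
    redAt-vertex t {a = a} {x} same = trans (cong (λ p → isRed ℓ (addZ ℓ (proj₁ p) t , proj₂ p)) same) (isRed-translate a x t)

    redTriple-shades : ∀ t → redTriple t ≡
      indicator (red (shade (signed x₀ σ₀) x₀ + toℕ t)) + indicator (red (shade (u + s) (levelAt k) + toℕ t))
      + indicator (red (shade (suc (u + s)) (levelAt (suc k)) + toℕ t))
    redTriple-shades t = cong₂ _+_ (cong₂ _+_ (cong indicator (redAt-vertex t {0} refl))
      (cong indicator (redAt-vertex t {k} position-k))) (cong indicator (redAt-vertex t {suc k} position-suc-k))

    redTriple-at : ∀ {b u′} t → levelAt k ≡ b → u ≡ u′ → redTriple t ≡
      indicator (red (shade (signed x₀ σ₀) x₀ + toℕ t)) + indicator (red (shade (u′ + s) b + toℕ t))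
      + indicator (red (shade (suc (u′ + s)) (not b) + toℕ t))
    redTriple-at t refl refl = redTriple-shades t

    module _ (value-injective : ValueInjective) where

      C : Cycle ℓ (2 * k)
      C = cycle value-injective

      edge-position : ∀ i → edge C i ≡ (position (toℕ i) , position (suc (toℕ i) % ℓ))
      edge-position i = cong (λ j → position (toℕ i) , position j) (toℕ-fromℕ< (m%n<n (suc (toℕ i)) ℓ))

      count-edges : ∀ (f : Edge ℓ → Bool) →
        countF ℓ (f ∘ edge C) ≡ count (2 * k) (λ Y → f (position Y , position (suc Y))) + indicator (f (position (2 * k) , position 0))
      count-edges f = begin
        countF ℓ (f ∘ edge C)                                   ≡⟨ countF-cong ℓ (cong f ∘ edge-position) ⟩
        countF ℓ (g ∘ toℕ)                                      ≡⟨ countF-toℕ ℓ g ⟩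
        count ℓ g                                               ≡⟨ count-snoc (2 * k) g ⟩
        count (2 * k) (λ Y → f (position Y , position (suc Y % ℓ))) + indicator (f (position (2 * k) , position (ℓ % ℓ)))
          ≡⟨ cong₂ (λ n b → n + indicator (f (position (2 * k) , position b)))
               (count-cong (2 * k) (λ Y Y<2k → cong (λ j → f (position Y , position j)) (m<n⇒m%n≡m {ℓ} {suc Y} (s≤s Y<2k))))
               (n%n≡0 ℓ) ⟩
        count (2 * k) (λ Y → f (position Y , position (suc Y))) + indicator (f (position (2 * k) , position 0)) ∎
        where
        open ≡-Reasoning
        g : ℕ → Bool
        g Y = f (position Y , position (suc Y % ℓ))

      position-last : position (2 * k) ≡ vertex (signed (not x₀) α) x₀
      position-last = begin
        position (2 * k)                                   ≡⟨ cong position (last q) ⟩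
        position (2 + k + suc q)                           ≡⟨ position-back {0} {suc q} refl ⟩
        vertex (signed (not x₀) α) (not (not x₀))          ≡⟨ cong (vertex (signed (not x₀) α)) (not-involutive x₀) ⟩
        vertex (signed (not x₀) α) x₀                      ∎
        where
        open ≡-Reasoning
        last : ∀ q → 2 * (3 + q) ≡ 2 + (3 + q) + suc q
        last = solve-∀

      edge-inner : ∀ (i : Fin ℓ) → toℕ i < 2 * k → edge C i ≡ (position (toℕ i) , position (suc (toℕ i)))
      edge-inner i i<2k = trans (edge-position i) (cong (λ j → position (toℕ i) , position j) (m<n⇒m%n≡m {ℓ} {suc (toℕ i)} (s≤s i<2k)))

      edge-last : ∀ (i : Fin ℓ) → toℕ i ≡ 2 * k → edge C i ≡ (vertex (signed (not x₀) α) x₀ , position 0)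
      edge-last i i≡2k = trans (edge-position i) (cong₂ (λ p j → p , position j)
        (trans (cong position i≡2k) position-last)
        (trans (cong (λ j → suc j % ℓ) i≡2k) (n%n≡0 ℓ)))

      -- the pure edge joins the two level-x₀ vertices at positions 2k and 0
      module _ (m : ℕ) (pure-difference : (signed (not x₀) α + (N ∸ m)) % N ≡ signed x₀ σ₀ % N) where

        edges-allowed : ∀ i → (isMixed ℓ (edge C i) ∨ isPureWith ℓ (level x₀) m (edge C i)) ≡ true
        edges-allowed i with toℕ i <? 2 * k
        ... | yes i<2k = cong (_∨ isPureWith ℓ (level x₀) m (edge C i))
          (trans (cong (isMixed ℓ) (edge-inner i i<2k)) (isMixed-level (value (fold (toℕ i))) (value (fold (suc (toℕ i)))) (levelAt (toℕ i))))
        ... | no i≮2k = trans (cong (isMixed ℓ (edge C i) ∨_)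
          (trans (cong (isPureWith ℓ (level x₀) m) (edge-last i (≤∧≮⇒≡ (≤-pred (toℕ<n i)) i≮2k)))
                 (isPure-same-level x₀ (signed (not x₀) α) (signed x₀ σ₀) m pure-difference)))
          (∨-zeroʳ _)

        pure-count : countF ℓ (λ i → isPureWith ℓ (level x₀) m (edge C i)) ≡ 1
        pure-count = begin
          countF ℓ (isPureWith ℓ (level x₀) m ∘ edge C)
            ≡⟨ count-edges (isPureWith ℓ (level x₀) m) ⟩
          count (2 * k) (λ Y → isPureWith ℓ (level x₀) m (position Y , position (suc Y)))
            + indicator (isPureWith ℓ (level x₀) m (position (2 * k) , position 0))
            ≡⟨ cong₂ (λ n b → n + indicator b)
                 (count-none (2 * k) (λ Y _ → isPure-level (level x₀) m (value (fold Y)) (value (fold (suc Y))) (levelAt Y)))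
                 (trans (cong (λ p → isPureWith ℓ (level x₀) m (p , position 0)) position-last)
                        (isPure-same-level x₀ (signed (not x₀) α) (signed x₀ σ₀) m pure-difference)) ⟩
          1 ∎
          where open ≡-Reasoning

      mixed-count : ∀ d → countF ℓ (λ i → isMixedWith ℓ d (edge C i)) ≡ count (2 * k) (hit d)
      mixed-count d = begin
        countF ℓ (isMixedWith ℓ d ∘ edge C)
          ≡⟨ count-edges (isMixedWith ℓ d) ⟩
        count (2 * k) (hit d) + indicator (isMixedWith ℓ d (position (2 * k) , position 0))
          ≡⟨ cong (λ p → count (2 * k) (hit d) + indicator (isMixedWith ℓ d (p , position 0))) position-last ⟩
        count (2 * k) (hit d) + indicator (isMixedWith ℓ d (vertex (signed (not x₀) α) x₀ , position 0))
          ≡⟨ cong (λ b → count (2 * k) (hit d) + indicator b) (isMixedWith-same-level d (signed (not x₀) α) (signed x₀ σ₀) x₀) ⟩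
        count (2 * k) (hit d) + 0
          ≡⟨ +-identityʳ _ ⟩
        count (2 * k) (hit d) ∎
        where open ≡-Reasoning

      redCount-redAt : ∀ t → redCount ℓ C t ≡ count ℓ (redAt t)
      redCount-redAt t = countF-toℕ ℓ (redAt t)

      -- mirrored positions have opposite colours, so only positions 0, k and k+1 matter
      red-count : ∀ t → count ℓ (redAt t) ≡ redTriple t + (2 + q)
      red-count t = begin
        count ℓ R
          ≡⟨ cong (λ n → count n R) (sections q) ⟩
        indicator (R 0) + count ((2 + q) + (2 + (2 + q))) (R ∘ suc)
          ≡⟨ cong (indicator (R 0) +_) (count-+ (2 + q) (2 + (2 + q)) (R ∘ suc)) ⟩
        indicator (R 0) + (count (2 + q) (R ∘ suc) + count (2 + (2 + q)) (λ x → R (suc (2 + q + x))))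
          ≡⟨ cong (λ n → indicator (R 0) + (count (2 + q) (R ∘ suc) + n)) middle-and-back ⟩
        indicator (R 0) + (count (2 + q) (R ∘ suc) + (indicator (R k) + (indicator (R (suc k)) + count (2 + q) (not ∘ R ∘ suc))))
          ≡⟨ regroup (indicator (R 0)) (count (2 + q) (R ∘ suc)) (indicator (R k)) (indicator (R (suc k))) (count (2 + q) (not ∘ R ∘ suc)) ⟩
        (indicator (R 0) + indicator (R k) + indicator (R (suc k))) + (count (2 + q) (R ∘ suc) + count (2 + q) (not ∘ R ∘ suc))
          ≡⟨ cong ((indicator (R 0) + indicator (R k) + indicator (R (suc k))) +_) (count-complement (2 + q) (R ∘ suc)) ⟩
        (indicator (R 0) + indicator (R k) + indicator (R (suc k))) + (2 + q) ∎
        where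
        open ≡-Reasoning
        R : ℕ → Bool
        R = redAt t
        sections : ∀ q → suc (2 * (3 + q)) ≡ 1 + ((2 + q) + (2 + (2 + q)))
        sections = solve-∀
        regroup : ∀ a b c e f → a + (b + (c + (e + f))) ≡ (a + c + e) + (b + f)
        regroup = solve-∀
        shift : ∀ q W → suc (2 + q + (2 + W)) ≡ 2 + (3 + q) + W
        shift = solve-∀
        middle-and-back : count (2 + (2 + q)) (λ x → R (suc (2 + q + x)))
          ≡ indicator (R k) + (indicator (R (suc k)) + count (2 + q) (not ∘ R ∘ suc))
        middle-and-back = cong₂ _+_ (cong (indicator ∘ R ∘ suc) (+-identityʳ (2 + q)))
          (cong₂ _+_ (cong (indicator ∘ R ∘ suc) (+-comm (2 + q) 1))
            (begin
              count (2 + q) (λ W → R (suc (2 + q + (2 + W))))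
                ≡⟨ count-cong (2 + q) (λ W W<2+q → trans (cong R (shift q W))
                     (red-mirror t (m∸n+n≡m (≤-pred W<2+q)))) ⟩
              count (2 + q) (λ W → not (R (suc (suc q ∸ W))))
                ≡⟨ count-reverse (2 + q) (not ∘ R ∘ suc) ⟩
              count (2 + q) (not ∘ R ∘ suc) ∎))

      equitable : ∀ t → OneOrTwo (redTriple t) →
        redCount ℓ C t ≡ k ⊎ redCount ℓ C t ≡ suc k
      equitable t (inj₁ one) = inj₁ (trans (redCount-redAt t) (trans (red-count t) (cong (_+ (2 + q)) one)))
      equitable t (inj₂ two) = inj₂ (trans (redCount-redAt t) (trans (red-count t) (cong (_+ (2 + q)) two)))

  -- The two cycles

  -- C₀ = 0₀ k₁ (k-2)₀ (k+1)₁ (k-3)₀ … u (u+k+1) (u+k+2) … (k-2)₁ k₀, closed by the pure edge k₀ 0₀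
  module C₀ = Mirrored false 0 k (3 * k + 4) (suc k)

  hits₀ : ∀ d → count (2 * k) (C₀.hit d) ≡
    window k 1 d + window 2 (suc q) d
    + (indicator (middle₁ C₀.y (suc k) % N ≡ᵇ d) + indicator (middle₂ C₀.y % N ≡ᵇ d) + indicator (middle₃ C₀.y (suc k) % N ≡ᵇ d))
    + window (3 * k + 3) (suc q) d
  hits₀ d = C₀.hits-by-window d
    (<N-via (suc k) (9 + 3 * q) ≤-refl (s<N q))
    (residue k 0 (sym (+-identityʳ k)) (<N-via k (10 + 3 * q) ≤-refl (k<N q)))
    (residue-shift 1 (front q) (<N-via (2 + q) (11 + 3 * q) ≤-refl (front< q)))
    (λ W W<1+q → residue-sum {k + (3 * k + 4)} {3 * k + 3} W W<1+q (back q))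
    (residue-shift 0 (sym (+-identityʳ _)) (<N-via (3 * k + 3 + q) 1 ≤-refl (back< q)))
    where
    s<N : ∀ q → suc (3 + q) + suc (9 + 3 * q) ≡ suc (2 * (3 + q)) + suc (2 * (3 + q))
    s<N = solve-∀
    k<N : ∀ q → (3 + q) + suc (10 + 3 * q) ≡ suc (2 * (3 + q)) + suc (2 * (3 + q))
    k<N = solve-∀
    front : ∀ q → (3 + q) + (3 * (3 + q) + 4) ≡ 2 + 1 * (suc (2 * (3 + q)) + suc (2 * (3 + q)))
    front = solve-∀
    front< : ∀ q → 2 + q + suc (11 + 3 * q) ≡ suc (2 * (3 + q)) + suc (2 * (3 + q))
    front< = solve-∀
    back : ∀ q → (3 + q) + (3 * (3 + q) + 4) + (3 * (3 + q) + 3) + q ≡ 2 * (suc (2 * (3 + q)) + suc (2 * (3 + q)))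
    back = solve-∀
    back< : ∀ q → 3 * (3 + q) + 3 + q + 2 ≡ suc (2 * (3 + q)) + suc (2 * (3 + q))
    back< = solve-∀

  -- C₁ = k₁ (2k)₀ (3k+3)₁ (2k-1)₀ (3k+4)₁ … u (u-k-2) (u-k-1) … (3k+3)₀ (2k)₁, closed by the pure edge (2k)₁ k₁
  module C₁ = Mirrored true k (2 * k + 2) (3 * k + 3) (3 * k)

  hits₁ : ∀ d → count (2 * k) (C₁.hit d) ≡
    window (3 * k + 2) 1 d + window (k + 3) (suc q) d
    + (indicator (middle₁ C₁.y (3 * k) % N ≡ᵇ d) + indicator (middle₂ C₁.y % N ≡ᵇ d) + indicator (middle₃ C₁.y (3 * k) % N ≡ᵇ d))
    + window (2 * k + 2) (suc q) d
  hits₁ d = C₁.hits-by-window d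
    (<N-via (3 * k) (4 + q) ≤-refl (s<N q))
    (residue (3 * k + 2) 0 (start-sum q) (<N-via (3 * k + 2) (2 + q) ≤-refl (start< q)))
    (residue-shift 1 (front q) (<N-via (k + 3 + q) (7 + 2 * q) ≤-refl (front< q)))
    (λ W W<1+q → residue-sum {2 * k + 2 + (3 * k + 3)} {2 * k + 2} W W<1+q (back q))
    (residue-shift 0 (sym (+-identityʳ _)) (<N-via (2 * k + 2 + q) (5 + q) ≤-refl (back< q)))
    where
    s<N : ∀ q → 3 * (3 + q) + suc (4 + q) ≡ suc (2 * (3 + q)) + suc (2 * (3 + q))
    s<N = solve-∀
    start-sum : ∀ q → 3 + q + (2 * (3 + q) + 2) ≡ 3 * (3 + q) + 2 + 0 * (suc (2 * (3 + q)) + suc (2 * (3 + q)))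
    start-sum = solve-∀
    start< : ∀ q → 3 * (3 + q) + 2 + suc (2 + q) ≡ suc (2 * (3 + q)) + suc (2 * (3 + q))
    start< = solve-∀
    front : ∀ q → 2 * (3 + q) + 2 + (3 * (3 + q) + 3) ≡ (3 + q) + 3 + 1 * (suc (2 * (3 + q)) + suc (2 * (3 + q)))
    front = solve-∀
    front< : ∀ q → 3 + q + 3 + q + suc (7 + 2 * q) ≡ suc (2 * (3 + q)) + suc (2 * (3 + q))
    front< = solve-∀
    back : ∀ q → 2 * (3 + q) + 2 + (3 * (3 + q) + 3) + (2 * (3 + q) + 2) + q ≡ 2 * (suc (2 * (3 + q)) + suc (2 * (3 + q)))
    back = solve-∀
    back< : ∀ q → 2 * (3 + q) + 2 + q + suc (5 + q) ≡ suc (2 * (3 + q)) + suc (2 * (3 + q))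
    back< = solve-∀

  -- position k-1 has opposite levels in C₀ and C₁, and between them the centre edges give
  -- ±1, ±(k+1), ±(k+2) whatever that level is
  middle-windows : ∀ y d →
    (indicator (middle₁ y (suc k) % N ≡ᵇ d) + indicator (middle₂ y % N ≡ᵇ d) + indicator (middle₃ y (suc k) % N ≡ᵇ d))
    + (indicator (middle₁ (not y) (3 * k) % N ≡ᵇ d) + indicator (middle₂ (not y) % N ≡ᵇ d) + indicator (middle₃ (not y) (3 * k) % N ≡ᵇ d))
    ≡ window 1 1 d + window (suc k) 1 d + window (2 + k) 1 d + window (3 * k) 1 d + window (3 * k + 1) 1 d + window (4 * k + 1) 1 d
  middle-windows false d = trans
    (cong₂ _+_
      (cong₂ _+_ (cong₂ _+_
        (indicator-residue (suc k) d (residue-< (suc k) refl (<N-via (suc k) (9 + 3 * q) ≤-refl (k+1<N q))))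
        (indicator-residue (N ∸ 1) d (residue-∸ (4 * k + 1) (4k+2≡N q) (s≤s z≤n))))
        (indicator-residue (N ∸ suc (suc k)) d (residue-∸ (3 * k) (3k+k+2≡N q) (s≤s z≤n))))
      (cong₂ _+_ (cong₂ _+_
        (indicator-residue (N ∸ 3 * k) d (residue-∸ (2 + k) (k+2+3k≡N q) (s≤s z≤n)))
        (indicator-residue 1 d (residue-< 1 refl (<N-via 1 (12 + 4 * q) ≤-refl (1<N q)))))
        (indicator-residue (suc (3 * k)) d (residue-< (3 * k + 1) (+-comm 1 (3 * k)) (<N-via (3 * k + 1) (3 + q) ≤-refl (3k+1+k+1≡N q))))))
    (reorder (w (suc k)) (w (4 * k + 1)) (w (3 * k)) (w (2 + k)) (w 1) (w (3 * k + 1)))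
    where
    reorder : ∀ a b c e f g → a + b + c + (e + f + g) ≡ f + a + e + c + g + b
    reorder = solve-∀
    w : ℕ → ℕ
    w v = window v 1 d
  middle-windows true d = trans
    (cong₂ _+_
      (cong₂ _+_ (cong₂ _+_
        (indicator-residue (N ∸ suc k) d (residue-∸ (3 * k + 1) (3k+1+k+1≡N q) (s≤s z≤n)))
        (indicator-residue 1 d (residue-< 1 refl (<N-via 1 (12 + 4 * q) ≤-refl (1<N q)))))
        (indicator-residue (suc (suc k)) d (residue-< (2 + k) refl (<N-via (2 + k) (8 + 3 * q) ≤-refl (k+2<N q)))))
      (cong₂ _+_ (cong₂ _+_
        (indicator-residue (3 * k) d (residue-< (3 * k) refl (<N-via (3 * k) (4 + q) ≤-refl (3k<N q))))
        (indicator-residue (N ∸ 1) d (residue-∸ (4 * k + 1) (4k+2≡N q) (s≤s z≤n))))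
        (indicator-residue (N ∸ suc (3 * k)) d (residue-∸ (suc k) (k+1+3k+1≡N q) (s≤s z≤n)))))
    (reorder (w (3 * k + 1)) (w 1) (w (2 + k)) (w (3 * k)) (w (4 * k + 1)) (w (suc k)))
    where
    reorder : ∀ a b c e f g → a + b + c + (e + f + g) ≡ b + g + c + e + a + f
    reorder = solve-∀
    w : ℕ → ℕ
    w v = window v 1 d

  lower-windows : ∀ d → window 1 1 d + window 2 (suc q) d + window k 1 d + window (suc k) 1 d + window (2 + k) 1 d
    + window (k + 3) (suc q) d ≡ window 1 (2 * k) d
  lower-windows d = trans (merge₆ {1} 1 (suc q) 1 1 1 (suc q) d refl refl (l₃ q) (l₄ q) (l₅ q)) (cong (λ n → window 1 n d) (l₆ q))
    where
    l₃ : ∀ q → 1 + (1 + suc q + 1) ≡ suc (3 + q)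
    l₃ = solve-∀
    l₄ : ∀ q → 1 + (1 + suc q + 1 + 1) ≡ 2 + (3 + q)
    l₄ = solve-∀
    l₅ : ∀ q → 1 + (1 + suc q + 1 + 1 + 1) ≡ (3 + q) + 3
    l₅ = solve-∀
    l₆ : ∀ q → 1 + suc q + 1 + 1 + 1 + suc q ≡ 2 * (3 + q)
    l₆ = solve-∀

  upper-windows : ∀ d → window (2 * k + 2) (suc q) d + window (3 * k) 1 d + window (3 * k + 1) 1 d + window (3 * k + 2) 1 d
    + window (3 * k + 3) (suc q) d + window (4 * k + 1) 1 d ≡ window (2 * k + 2) (2 * k) d
  upper-windows d = trans (merge₆ {2 * k + 2} (suc q) 1 1 1 (suc q) 1 d (u₂ q) (u₃ q) (u₄ q) (u₅ q) (u₆ q))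
    (cong (λ n → window (2 * k + 2) n d) (u₇ q))
    where
    u₂ : ∀ q → 2 * (3 + q) + 2 + suc q ≡ 3 * (3 + q)
    u₂ = solve-∀
    u₃ : ∀ q → 2 * (3 + q) + 2 + (suc q + 1) ≡ 3 * (3 + q) + 1
    u₃ = solve-∀
    u₄ : ∀ q → 2 * (3 + q) + 2 + (suc q + 1 + 1) ≡ 3 * (3 + q) + 2
    u₄ = solve-∀
    u₅ : ∀ q → 2 * (3 + q) + 2 + (suc q + 1 + 1 + 1) ≡ 3 * (3 + q) + 3
    u₅ = solve-∀
    u₆ : ∀ q → 2 * (3 + q) + 2 + (suc q + 1 + 1 + 1 + suc q) ≡ 4 * (3 + q) + 1
    u₆ = solve-∀
    u₇ : ∀ q → suc q + 1 + 1 + 1 + suc q + 1 ≡ 2 * (3 + q)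
    u₇ = solve-∀

  windows-cover : ∀ d → 0 < d → d < N → ℓ ≢ d → window 1 (2 * k) d + window (2 * k + 2) (2 * k) d ≡ 1
  windows-cover d 0<d d<N ℓ≢d = begin
    w 1 (2 * k) + w (2 * k + 2) (2 * k)
      ≡⟨ cong (_+ w (2 * k + 2) (2 * k)) (trans (sym (+-identityʳ _)) (cong (w 1 (2 * k) +_) (sym (window-∌ ℓ d ℓ≢d)))) ⟩
    w 1 (2 * k) + w ℓ 1 + w (2 * k + 2) (2 * k)
      ≡⟨ cong (_+ w (2 * k + 2) (2 * k)) (window-+ 1 (2 * k) 1 d) ⟩
    w 1 (2 * k + 1) + w (2 * k + 2) (2 * k)
      ≡⟨ merge {1} {2 * k + 1} (2 * k) d (gap q) ⟩
    w 1 (2 * k + 1 + 2 * k)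
      ≡⟨ window-∋ 1 (2 * k + 1 + 2 * k) d 0<d (subst (d <_) (whole q) d<N) ⟩
    1 ∎
    where
    open ≡-Reasoning
    w : ℕ → ℕ → ℕ
    w lo n = window lo n d
    gap : ∀ q → 1 + (2 * (3 + q) + 1) ≡ 2 * (3 + q) + 2
    gap = solve-∀
    whole : ∀ q → suc (2 * (3 + q)) + suc (2 * (3 + q)) ≡ 1 + (2 * (3 + q) + 1 + 2 * (3 + q))
    whole = solve-∀

  hits-partition : ∀ d → 0 < d → d < N → ℓ ≢ d → count (2 * k) (C₀.hit d) + count (2 * k) (C₁.hit d) ≡ 1
  hits-partition d 0<d d<N ℓ≢d = begin
    count (2 * k) (C₀.hit d) + count (2 * k) (C₁.hit d)
      ≡⟨ cong₂ _+_ (hits₀ d) (hits₁ d) ⟩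
    (E₀ + F₀ + M₀ + B₀) + (E₁ + F₁ + M₁ + B₁)
      ≡⟨ separate E₀ F₀ M₀ B₀ E₁ F₁ M₁ B₁ ⟩
    (E₀ + F₀ + B₀ + E₁ + F₁ + B₁) + (M₀ + M₁)
      ≡⟨ cong ((E₀ + F₀ + B₀ + E₁ + F₁ + B₁) +_) middles ⟩
    (E₀ + F₀ + B₀ + E₁ + F₁ + B₁) + (w 1 1 + w (suc k) 1 + w (2 + k) 1 + w (3 * k) 1 + w (3 * k + 1) 1 + w (4 * k + 1) 1)
      ≡⟨ sort E₀ F₀ B₀ E₁ F₁ B₁ (w 1 1) (w (suc k) 1) (w (2 + k) 1) (w (3 * k) 1) (w (3 * k + 1) 1) (w (4 * k + 1) 1) ⟩
    (w 1 1 + F₀ + E₀ + w (suc k) 1 + w (2 + k) 1 + F₁) + (B₁ + w (3 * k) 1 + w (3 * k + 1) 1 + E₁ + B₀ + w (4 * k + 1) 1)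
      ≡⟨ cong₂ _+_ (lower-windows d) (upper-windows d) ⟩
    w 1 (2 * k) + w (2 * k + 2) (2 * k)
      ≡⟨ windows-cover d 0<d d<N ℓ≢d ⟩
    1 ∎
    where
    open ≡-Reasoning
    w : ℕ → ℕ → ℕ
    w lo n = window lo n d
    M : Bool → ℕ
    M y = indicator (middle₁ y (3 * k) % N ≡ᵇ d) + indicator (middle₂ y % N ≡ᵇ d) + indicator (middle₃ y (3 * k) % N ≡ᵇ d)
    E₀ F₀ B₀ E₁ F₁ B₁ M₀ M₁ : ℕ
    E₀ = w k 1
    F₀ = w 2 (suc q)
    B₀ = w (3 * k + 3) (suc q)
    E₁ = w (3 * k + 2) 1
    F₁ = w (k + 3) (suc q)
    B₁ = w (2 * k + 2) (suc q)
    M₀ = indicator (middle₁ C₀.y (suc k) % N ≡ᵇ d) + indicator (middle₂ C₀.y % N ≡ᵇ d) + indicator (middle₃ C₀.y (suc k) % N ≡ᵇ d)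
    M₁ = M C₁.y
    separate : ∀ a b c e f g h i → a + b + c + e + (f + g + h + i) ≡ a + b + e + f + g + i + (c + h)
    separate = solve-∀
    sort : ∀ a b c e f g s₁ s₂ s₃ s₄ s₅ s₆ → a + b + c + e + f + g + (s₁ + s₂ + s₃ + s₄ + s₅ + s₆) ≡
      (s₁ + b + a + s₂ + s₃ + f) + (g + s₄ + s₅ + e + c + s₆)
    sort = solve-∀
    middles : M₀ + M₁ ≡ w 1 1 + w (suc k) 1 + w (2 + k) 1 + w (3 * k) 1 + w (3 * k + 1) 1 + w (4 * k + 1) 1
    middles = trans (cong (λ y → M₀ + M y) (alternate-not false (2 + q))) (middle-windows C₀.y d)

  residue₀-up : ∀ i → i + i < 2 + q → C₀.value (suc (i + i)) % N ≡ k + i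
  residue₀-up i 2i<2+q = residue-< (k + i) (C₀.value-up i 2i<2+q)
    (<N-via (k + suc q) (9 + 2 * q) (+-monoʳ-≤ k (≤-trans (m≤m+n i i) (≤-pred 2i<2+q))) (bound q))
    where
    bound : ∀ q → 3 + q + suc q + suc (9 + 2 * q) ≡ suc (2 * (3 + q)) + suc (2 * (3 + q))
    bound = solve-∀

  residue₀-down : ∀ i e → i + i + e ≡ q → C₀.value (suc (suc (i + i))) % N ≡ suc (i + e)
  residue₀-down i e 2i+e≡q = residue-< (suc (i + e))
    (trans (C₀.value-down i 2i+1<2+q) (negate-exact {3 * k + 4 + i} (down-value₀ i e 2i+e≡q) (s≤s z≤n)))
    (<-trans (down-bound₀ i e 2i+e≡q) (<N-via k (10 + 3 * q) ≤-refl (k<N q)))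
    where
    2i+1<2+q : suc (i + i) < 2 + q
    2i+1<2+q = s≤s (s≤s (subst (i + i ≤_) 2i+e≡q (m≤m+n (i + i) e)))
    k<N : ∀ q → 3 + q + suc (10 + 3 * q) ≡ suc (2 * (3 + q)) + suc (2 * (3 + q))
    k<N = solve-∀

  module _ (u-above : ∀ i → i + i < 2 + q → i ≤ C₀.u) (u-below : suc (C₀.u + suc k) < N) where

    index₀ : ℕ → ℕ
    index₀ w =
      if w ≡ᵇ 0 then 0 else
      if w <ᵇ k then 2 * (k ∸ suc w) else
      if w ≡ᵇ C₀.u + suc k then k else
      if w ≡ᵇ suc (C₀.u + suc k) then suc k else
      suc (2 * (w ∸ k))

    up-below-centre : ∀ i → i + i < 2 + q → k + i < C₀.u + suc k
    up-below-centre i 2i<2+q = begin-strict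
      k + i           ≤⟨ +-monoʳ-≤ k (u-above i 2i<2+q) ⟩
      k + C₀.u        ≡⟨ +-comm k C₀.u ⟩
      C₀.u + k        <⟨ n<1+n _ ⟩
      suc (C₀.u + k)  ≡⟨ +-suc C₀.u k ⟨
      C₀.u + suc k    ∎
      where open ≤-Reasoning

    index₀-up : ∀ i → i + i < 2 + q → index₀ (k + i) ≡ suc (i + i)
    index₀-up i 2i<2+q = begin
      index₀ (k + i)         ≡⟨ if-false (dec-false (k + i <? k) (m+n≮m k i)) ⟩
      _                      ≡⟨ if-false (dec-false (k + i ≟ C₀.u + suc k) (<⇒≢ (up-below-centre i 2i<2+q))) ⟩
      _                      ≡⟨ if-false (dec-false (k + i ≟ suc (C₀.u + suc k)) (<⇒≢ (m<n⇒m<1+n (up-below-centre i 2i<2+q)))) ⟩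
      suc (2 * (k + i ∸ k))  ≡⟨ cong (λ n → suc (2 * n)) (m+n∸m≡n k i) ⟩
      suc (2 * i)            ≡⟨ cong (λ n → suc (i + n)) (+-identityʳ i) ⟩
      suc (i + i)            ∎
      where open ≡-Reasoning

    index₀-down : ∀ i e → i + i + e ≡ q → index₀ (suc (i + e)) ≡ suc (suc (i + i))
    index₀-down i e 2i+e≡q =
      trans (if-true (dec-true (suc (i + e) <? k) (down-bound₀ i e 2i+e≡q))) (down-index₀ i e 2i+e≡q)

    index₀-mid : index₀ (C₀.u + suc k) ≡ k
    index₀-mid = begin
      index₀ (C₀.u + suc k) ≡⟨ if-false (dec-false (C₀.u + suc k ≟ 0) (m+1+n≢0 C₀.u)) ⟩
      _                     ≡⟨ if-false (dec-false (C₀.u + suc k <? k) (≤⇒≯ (≤-trans (n≤1+n k) (m≤n+m (suc k) C₀.u)))) ⟩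
      _                     ≡⟨ if-true (dec-true (C₀.u + suc k ≟ C₀.u + suc k) refl) ⟩
      k                     ∎
      where open ≡-Reasoning

    index₀-mid′ : index₀ (suc (C₀.u + suc k)) ≡ suc k
    index₀-mid′ = begin
      index₀ (suc (C₀.u + suc k))
        ≡⟨ if-false (dec-false (suc (C₀.u + suc k) <? k) (≤⇒≯ (≤-trans (n≤1+n k) (≤-trans (m≤n+m (suc k) C₀.u) (n≤1+n _))))) ⟩
      _ ≡⟨ if-false (dec-false (suc (C₀.u + suc k) ≟ C₀.u + suc k) 1+n≢n) ⟩
      _ ≡⟨ if-true (dec-true (suc (C₀.u + suc k) ≟ suc (C₀.u + suc k)) refl) ⟩
      suc k ∎
      where open ≡-Reasoning

    index₀-value : ∀ {Z} → Section Z → index₀ (C₀.value Z % N) ≡ Z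
    index₀-value start          = cong index₀ (n%n≡0 N)
    index₀-value (up i 2i<2+q)  = trans (cong index₀ (residue₀-up i 2i<2+q)) (index₀-up i 2i<2+q)
    index₀-value (down i 2i+1<2+q) with m≤n⇒∃[o]m+o≡n (≤-pred (≤-pred 2i+1<2+q))
    ... | e , 2i+e≡q = trans (cong index₀ (residue₀-down i e 2i+e≡q)) (index₀-down i e 2i+e≡q)
    index₀-value mid  = trans (cong index₀ (residue-< (C₀.u + suc k) C₀.value-k (<-trans (n<1+n _) u-below))) index₀-mid
    index₀-value mid′ = trans (cong index₀ (residue-< (suc (C₀.u + suc k)) C₀.value-suc-k u-below)) index₀-mid′

    value-injective₀ : C₀.ValueInjective
    value-injective₀ Z< Z′< same = trans (sym (index₀-value (section Z<))) (trans (cong index₀ same) (index₀-value (section Z′<)))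

  centre₁ : ℕ
  centre₁ = (C₁.u + 3 * k) % N

  residue₁-up : ∀ i e → i + i + e ≡ suc q → C₁.value (suc (i + i)) % N ≡ 4 + 3 * i + 2 * e
  residue₁-up i e 2i+e≡1+q = residue-< (4 + 3 * i + 2 * e)
    (trans (C₁.value-up i 2i<2+q) (negate-exact {2 * k + 2 + i} (up-value₁ i e 2i+e≡1+q) (s≤s z≤n)))
    (≤-<-trans (up-below₁ i e 2i+e≡1+q) (<N-via (2 * k) (7 + 2 * q) ≤-refl (2k<N q)))
    where
    2i<2+q : i + i < 2 + q
    2i<2+q = s≤s (subst (i + i ≤_) 2i+e≡1+q (m≤m+n (i + i) e))
    2k<N : ∀ q → 2 * (3 + q) + suc (7 + 2 * q) ≡ suc (2 * (3 + q)) + suc (2 * (3 + q))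
    2k<N = solve-∀

  residue₁-down : ∀ i → suc (i + i) < 2 + q → C₁.value (suc (suc (i + i))) % N ≡ 3 * k + 3 + i
  residue₁-down i 2i+1<2+q = residue-< (3 * k + 3 + i) (C₁.value-down i 2i+1<2+q)
    (<N-via (3 * k + 3 + q) 1 (+-monoʳ-≤ (3 * k + 3) (≤-trans (m≤m+n i i) (≤-pred (≤-pred 2i+1<2+q)))) (bound q))
    where
    bound : ∀ q → 3 * (3 + q) + 3 + q + 2 ≡ suc (2 * (3 + q)) + suc (2 * (3 + q))
    bound = solve-∀

  module _ (placed : suc centre₁ < k ⊎ (2 * k < centre₁ × suc centre₁ < 3 * k + 3)) where

    index₁ : ℕ → ℕ
    index₁ w =
      if w ≡ᵇ k then 0 else
      if w ≡ᵇ centre₁ then k else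
      if w ≡ᵇ suc centre₁ then suc k else
      if w <ᵇ suc (2 * k) then suc (2 * (2 * k ∸ w)) else
      suc (suc (2 * (w ∸ (3 * k + 3))))

    -- the middle values fall into a gap of the other values, whichever gap that is
    apart : ∀ {w} → k < w → w ≤ 2 * k ⊎ 3 * k + 3 ≤ w → w ≢ centre₁ × w ≢ suc centre₁
    apart {w} k<w side = separated (gap placed side)
      where
      gap : suc centre₁ < k ⊎ (2 * k < centre₁ × suc centre₁ < 3 * k + 3) → w ≤ 2 * k ⊎ 3 * k + 3 ≤ w →
        w < centre₁ ⊎ suc centre₁ < w
      gap (inj₁ 1+c<k)            _             = inj₂ (<-trans 1+c<k k<w)
      gap (inj₂ (2k<c , _))       (inj₁ w≤2k)   = inj₁ (≤-<-trans w≤2k 2k<c)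
      gap (inj₂ (_ , 1+c<3k+3))   (inj₂ 3k+3≤w) = inj₂ (<-≤-trans 1+c<3k+3 3k+3≤w)
      separated : w < centre₁ ⊎ suc centre₁ < w → w ≢ centre₁ × w ≢ suc centre₁
      separated (inj₁ w<c)   = <⇒≢ w<c , <⇒≢ (m<n⇒m<1+n w<c)
      separated (inj₂ 1+c<w) = (λ w≡c → <⇒≢ (<-trans (n<1+n centre₁) 1+c<w) (sym w≡c)) , (λ w≡1+c → <⇒≢ 1+c<w (sym w≡1+c))

    centre-not-start : centre₁ ≢ k × suc centre₁ ≢ k
    centre-not-start = from placed
      where
      from : suc centre₁ < k ⊎ (2 * k < centre₁ × suc centre₁ < 3 * k + 3) → centre₁ ≢ k × suc centre₁ ≢ k
      from (inj₁ 1+c<k) = <⇒≢ (<-trans (n<1+n centre₁) 1+c<k) , <⇒≢ 1+c<k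
      from (inj₂ (2k<c , _)) = (λ c≡k → <⇒≢ k<c (sym c≡k)) , (λ 1+c≡k → <⇒≢ (<-trans k<c (n<1+n centre₁)) (sym 1+c≡k))
        where
        k<c : k < centre₁
        k<c = ≤-<-trans (m≤m+n k (k + 0)) 2k<c

    1+centre<N : suc centre₁ < N
    1+centre<N = from placed
      where
      k<N : ∀ q → 3 + q + suc (10 + 3 * q) ≡ suc (2 * (3 + q)) + suc (2 * (3 + q))
      k<N = solve-∀
      3k+3<N : ∀ q → 3 * (3 + q) + 3 + suc (suc q) ≡ suc (2 * (3 + q)) + suc (2 * (3 + q))
      3k+3<N = solve-∀
      from : suc centre₁ < k ⊎ (2 * k < centre₁ × suc centre₁ < 3 * k + 3) → suc centre₁ < N
      from (inj₁ 1+c<k)          = <-trans 1+c<k (<N-via k (10 + 3 * q) ≤-refl (k<N q))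
      from (inj₂ (_ , 1+c<3k+3)) = <-trans 1+c<3k+3 (<N-via (3 * k + 3) (suc q) ≤-refl (3k+3<N q))

    index₁-up : ∀ i e → i + i + e ≡ suc q → index₁ (4 + 3 * i + 2 * e) ≡ suc (i + i)
    index₁-up i e 2i+e≡1+q = begin
      index₁ r               ≡⟨ if-false (dec-false (r ≟ k) (λ r≡k → <⇒≢ k<r (sym r≡k))) ⟩
      _                      ≡⟨ if-false (dec-false (r ≟ centre₁) (proj₁ (apart k<r (inj₁ r≤2k)))) ⟩
      _                      ≡⟨ if-false (dec-false (r ≟ suc centre₁) (proj₂ (apart k<r (inj₁ r≤2k)))) ⟩
      _                      ≡⟨ if-true (dec-true (r <? suc (2 * k)) (s≤s r≤2k)) ⟩
      suc (2 * (2 * k ∸ r))  ≡⟨ cong (λ n → suc (2 * n)) (trans (cong (_∸ r) (up-twice₁ i e 2i+e≡1+q)) (m+n∸m≡n r i)) ⟩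
      suc (2 * i)            ≡⟨ cong (λ n → suc (i + n)) (+-identityʳ i) ⟩
      suc (i + i)            ∎
      where
      open ≡-Reasoning
      r : ℕ
      r = 4 + 3 * i + 2 * e
      k<r : k < r
      k<r = up-above₁ i e 2i+e≡1+q
      r≤2k : r ≤ 2 * k
      r≤2k = up-below₁ i e 2i+e≡1+q

    index₁-down : ∀ i → index₁ (3 * k + 3 + i) ≡ suc (suc (i + i))
    index₁-down i = begin
      index₁ v                           ≡⟨ if-false (dec-false (v ≟ k) (λ v≡k → <⇒≢ k<v (sym v≡k))) ⟩
      _                                  ≡⟨ if-false (dec-false (v ≟ centre₁) (proj₁ (apart k<v (inj₂ (m≤m+n (3 * k + 3) i))))) ⟩
      _                                  ≡⟨ if-false (dec-false (v ≟ suc centre₁) (proj₂ (apart k<v (inj₂ (m≤m+n (3 * k + 3) i))))) ⟩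
      _                                  ≡⟨ if-false (dec-false (v <? suc (2 * k)) (<⇒≱ 2k<v ∘ ≤-pred)) ⟩
      suc (suc (2 * (v ∸ (3 * k + 3))))  ≡⟨ cong (λ n → suc (suc (2 * n))) (m+n∸m≡n (3 * k + 3) i) ⟩
      suc (suc (2 * i))                  ≡⟨ cong (λ n → suc (suc (i + n))) (+-identityʳ i) ⟩
      suc (suc (i + i))                  ∎
      where
      open ≡-Reasoning
      v : ℕ
      v = 3 * k + 3 + i
      2k<v : 2 * k < v
      2k<v = <-≤-trans (<-by (k + 2) (lemma k)) (m≤m+n (3 * k + 3) i)
        where
        lemma : ∀ k → 2 * k + suc (k + 2) ≡ 3 * k + 3
        lemma = solve-∀
      k<v : k < v
      k<v = ≤-<-trans (m≤m+n k (k + 0)) 2k<v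

    index₁-mid : index₁ centre₁ ≡ k
    index₁-mid = trans (if-false (dec-false (centre₁ ≟ k) (proj₁ centre-not-start))) (if-true (dec-true (centre₁ ≟ centre₁) refl))

    index₁-mid′ : index₁ (suc centre₁) ≡ suc k
    index₁-mid′ = trans (if-false (dec-false (suc centre₁ ≟ k) (proj₂ centre-not-start)))
      (trans (if-false (dec-false (suc centre₁ ≟ centre₁) 1+n≢n)) (if-true (dec-true (suc centre₁ ≟ suc centre₁) refl)))

    index₁-value : ∀ {Z} → Section Z → index₁ (C₁.value Z % N) ≡ Z
    index₁-value start = trans (cong index₁ (residue-< k refl (<N-via k (10 + 3 * q) ≤-refl (k<N q)))) (if-true (dec-true (k ≟ k) refl))
      where
      k<N : ∀ q → 3 + q + suc (10 + 3 * q) ≡ suc (2 * (3 + q)) + suc (2 * (3 + q))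
      k<N = solve-∀
    index₁-value (up i 2i<2+q) with m≤n⇒∃[o]m+o≡n (≤-pred 2i<2+q)
    ... | e , 2i+e≡1+q = trans (cong index₁ (residue₁-up i e 2i+e≡1+q)) (index₁-up i e 2i+e≡1+q)
    index₁-value (down i 2i+1<2+q) = trans (cong index₁ (residue₁-down i 2i+1<2+q)) (index₁-down i)
    index₁-value mid  = trans (cong (λ v → index₁ (v % N)) C₁.value-k) index₁-mid
    index₁-value mid′ = trans (cong index₁ (trans (cong (_% N) C₁.value-suc-k) (suc-residue (C₁.u + 3 * k) 1+centre<N))) index₁-mid′

    value-injective₁ : C₁.ValueInjective
    value-injective₁ Z< Z′< same = trans (sym (index₁-value (section Z<))) (trans (cong index₁ same) (index₁-value (section Z′<)))

  pure₀ : (signed (not false) k + (N ∸ k)) % N ≡ signed false 0 % N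
  pure₀ = cong (_% N) (m+[n∸m]≡n (≤-trans (m≤m+n k (k + 0)) (≤-trans (n≤1+n _) (m≤m+n ℓ ℓ))))

  pure₁ : (signed (not true) (2 * k + 2) + (N ∸ k)) % N ≡ signed true k % N
  pure₁ = ≡-mod k 1 (begin
    negate (2 * k + 2) + (N ∸ k) ≡⟨ cong₂ _+_ (negate-exact {2 * k + 2} (twice q) (s≤s z≤n)) (∸-exact {k} {3 * k + 2} (thrice q)) ⟩
    2 * k + (3 * k + 2)          ≡⟨ once q ⟩
    k + 1 * N                    ∎)
    where
    open ≡-Reasoning
    twice : ∀ q → 2 * (3 + q) + 2 + 2 * (3 + q) ≡ suc (2 * (3 + q)) + suc (2 * (3 + q))
    twice = solve-∀
    thrice : ∀ q → 3 * (3 + q) + 2 + (3 + q) ≡ suc (2 * (3 + q)) + suc (2 * (3 + q))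
    thrice = solve-∀
    once : ∀ q → 2 * (3 + q) + (3 * (3 + q) + 2) ≡ (3 + q) + 1 * (suc (2 * (3 + q)) + suc (2 * (3 + q)))
    once = solve-∀

  -- The remaining facts depend on the parity of q, which decides whether position k-1 lies on the
  -- α- or on the β-strand of the zigzag.
  record ParityFacts : Set where
    field
      u₀-above       : ∀ i → i + i < 2 + q → i ≤ C₀.u
      u₀-below       : suc (C₀.u + suc k) < N
      centre₁-placed : suc centre₁ < k ⊎ (2 * k < centre₁ × suc centre₁ < 3 * k + 3)
      balanced₀      : ∀ t → OneOrTwo (C₀.redTriple t)
      balanced₁      : ∀ t → OneOrTwo (C₁.redTriple t)

-- Parity of q

module EvenCase (h : ℕ) where
  open Construction (h + h)

  u₀≡ : C₀.u ≡ suc h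
  u₀≡ = trans (C₀.front-down h) (negate-exact {3 * k + 4 + h} (lemma h) (s≤s z≤n))
    where
    lemma : ∀ h → 3 * (3 + (h + h)) + 4 + h + suc h ≡ suc (2 * (3 + (h + h))) + suc (2 * (3 + (h + h)))
    lemma = solve-∀

  centre₁≡ : centre₁ ≡ 2 * k + 1 + h
  centre₁≡ = residue (2 * k + 1 + h) 1 (trans (cong (_+ 3 * k) (C₁.front-down h)) (sum h))
    (<N-via (2 * k + 1 + h) (6 + 3 * h) ≤-refl (bound h))
    where
    sum : ∀ h → 3 * (3 + (h + h)) + 3 + h + 3 * (3 + (h + h)) ≡ 2 * (3 + (h + h)) + 1 + h + 1 * (suc (2 * (3 + (h + h))) + suc (2 * (3 + (h + h))))
    sum = solve-∀
    bound : ∀ h → 2 * (3 + (h + h)) + 1 + h + suc (6 + 3 * h) ≡ suc (2 * (3 + (h + h))) + suc (2 * (3 + (h + h)))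
    bound = solve-∀

  u₀-above : ∀ i → i + i < 2 + (h + h) → i ≤ C₀.u
  u₀-above i 2i<2+q = subst (i ≤_) (sym u₀≡) (≤-trans (half-≤ (≤-pred 2i<2+q)) (n≤1+n h))

  u₀-below : suc (C₀.u + suc k) < N
  u₀-below = subst (λ u → suc (u + suc k) < N) (sym u₀≡) (<N-via (suc (suc h + suc k)) (7 + 5 * h) ≤-refl (below h))
    where
    below : ∀ h → suc (suc h + suc (3 + (h + h))) + suc (7 + 5 * h) ≡ suc (2 * (3 + (h + h))) + suc (2 * (3 + (h + h)))
    below = solve-∀

  centre₁-placed : suc centre₁ < k ⊎ (2 * k < centre₁ × suc centre₁ < 3 * k + 3)
  centre₁-placed = inj₂ (subst (2 * k <_) (sym centre₁≡) (<-by h (assoc h))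
                        , subst (λ c → suc c < 3 * k + 3) (sym centre₁≡) (<-by (3 + h) (placed h)))
    where
    assoc : ∀ h → 2 * (3 + (h + h)) + suc h ≡ 2 * (3 + (h + h)) + 1 + h
    assoc = solve-∀
    placed : ∀ h → suc (2 * (3 + (h + h)) + 1 + h) + suc (3 + h) ≡ 3 * (3 + (h + h)) + 3
    placed = solve-∀

  -- position 0 and the middle positions k+1, k sit at 0, f and f + g on the circle
  balanced₀ : ∀ t → OneOrTwo (C₀.redTriple t)
  balanced₀ t = subst OneOrTwo (sym (C₀.redTriple-at t level-k u₀≡))
    (OneOrTwo-swap (reds t N) (reds t (suc (suc h + suc k))) (reds t (suc h + suc k + ℓ))
      (arc-balanced {suc (suc h + suc k)} {2 * k} (≤-by (suc h) (f≤ℓ h)) (n≤1+n (2 * k)) (≤-by (5 + 3 * h) (ℓ≤f+g h))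
        N (suc (suc h + suc k)) (suc h + suc k + ℓ) 0 (n%n≡0 N) refl (cong (_% N) (third h)) (toℕ t)))
    where
    level-k : C₀.levelAt k ≡ true
    level-k = cong (λ b → not (not (not b))) (alternate-double false h)
    f≤ℓ : ∀ h → suc (suc h + suc (3 + (h + h))) + suc h ≡ suc (2 * (3 + (h + h)))
    f≤ℓ = solve-∀
    ℓ≤f+g : ∀ h → suc (2 * (3 + (h + h))) + (5 + 3 * h) ≡ suc (suc h + suc (3 + (h + h))) + 2 * (3 + (h + h))
    ℓ≤f+g = solve-∀
    third : ∀ h → suc h + suc (3 + (h + h)) + suc (2 * (3 + (h + h))) ≡ 0 + suc (suc h + suc (3 + (h + h))) + 2 * (3 + (h + h))
    third = solve-∀

  -- the middle positions k+1, k and position 0 sit at a, a + f and a + f + g on the circle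
  balanced₁ : ∀ t → OneOrTwo (C₁.redTriple t)
  balanced₁ t = subst OneOrTwo (sym (C₁.redTriple-at t level-k (C₁.front-down h)))
    (OneOrTwo-reverse (reds t (suc (3 * k + 3 + h + 3 * k) + ℓ)) (reds t (3 * k + 3 + h + 3 * k)) (reds t (k + ℓ))
      (arc-balanced {2 * k} {3 + h} (n≤1+n (2 * k)) (≤-by (4 + 3 * h) (g≤ℓ h)) (≤-by (2 + h) (ℓ≤f+g h))
        (suc (3 * k + 3 + h + 3 * k) + ℓ) (3 * k + 3 + h + 3 * k) (k + ℓ) (suc h)
        (≡-mod (suc h) 2 (first h)) (≡-mod (suc h + 2 * k) 1 (second h)) (cong (_% N) (third h)) (toℕ t)))
    where
    level-k : C₁.levelAt k ≡ false
    level-k = cong (λ b → not (not (not b))) (alternate-double true h)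
    g≤ℓ : ∀ h → 3 + h + (4 + 3 * h) ≡ suc (2 * (3 + (h + h)))
    g≤ℓ = solve-∀
    ℓ≤f+g : ∀ h → suc (2 * (3 + (h + h))) + (2 + h) ≡ 2 * (3 + (h + h)) + (3 + h)
    ℓ≤f+g = solve-∀
    first : ∀ h → suc (3 * (3 + (h + h)) + 3 + h + 3 * (3 + (h + h))) + suc (2 * (3 + (h + h)))
      ≡ suc h + 2 * (suc (2 * (3 + (h + h))) + suc (2 * (3 + (h + h))))
    first = solve-∀
    second : ∀ h → 3 * (3 + (h + h)) + 3 + h + 3 * (3 + (h + h)) ≡ suc h + 2 * (3 + (h + h)) + 1 * (suc (2 * (3 + (h + h))) + suc (2 * (3 + (h + h))))
    second = solve-∀
    third : ∀ h → 3 + (h + h) + suc (2 * (3 + (h + h))) ≡ suc h + 2 * (3 + (h + h)) + (3 + h)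
    third = solve-∀

  facts : ParityFacts
  facts = record
    { u₀-above = u₀-above ; u₀-below = u₀-below ; centre₁-placed = centre₁-placed
    ; balanced₀ = balanced₀ ; balanced₁ = balanced₁ }

module OddCase (h : ℕ) where
  open Construction (suc (h + h))

  u-index : suc (suc (h + h)) ≡ suc h + suc h
  u-index = cong suc (sym (+-suc h h))

  u₀≡ : C₀.u ≡ k + suc h
  u₀≡ = trans (cong C₀.front u-index) (C₀.front-up (suc h))

  u₁≡ : C₁.u ≡ 7 + 3 * h
  u₁≡ = trans (cong C₁.front u-index) (trans (C₁.front-up (suc h)) (negate-exact {2 * k + 2 + suc h} (lemma h) (s≤s z≤n)))
    where
    lemma : ∀ h → 2 * (3 + suc (h + h)) + 2 + suc h + (7 + 3 * h) ≡ suc (2 * (3 + suc (h + h))) + suc (2 * (3 + suc (h + h)))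
    lemma = solve-∀

  centre₁≡ : centre₁ ≡ suc h
  centre₁≡ = residue (suc h) 1 (trans (cong (_+ 3 * k) u₁≡) (sum h)) (<N-via (suc h) (16 + 7 * h) ≤-refl (bound h))
    where
    sum : ∀ h → 7 + 3 * h + 3 * (3 + suc (h + h)) ≡ suc h + 1 * (suc (2 * (3 + suc (h + h))) + suc (2 * (3 + suc (h + h))))
    sum = solve-∀
    bound : ∀ h → suc h + suc (16 + 7 * h) ≡ suc (2 * (3 + suc (h + h))) + suc (2 * (3 + suc (h + h)))
    bound = solve-∀

  u₀-above : ∀ i → i + i < 2 + suc (h + h) → i ≤ C₀.u
  u₀-above i 2i<2+q = subst (i ≤_) (sym u₀≡) (≤-trans (m≤m+n i i) (≤-trans (≤-pred 2i<2+q) (≤-by (3 + h) (above h))))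
    where
    above : ∀ h → suc (suc (h + h)) + (3 + h) ≡ 3 + suc (h + h) + suc h
    above = solve-∀

  u₀-below : suc (C₀.u + suc k) < N
  u₀-below = subst (λ u → suc (u + suc k) < N) (sym u₀≡) (<N-via (suc (k + suc h + suc k)) (6 + 3 * h) ≤-refl (below h))
    where
    below : ∀ h → suc (3 + suc (h + h) + suc h + suc (3 + suc (h + h))) + suc (6 + 3 * h) ≡ suc (2 * (3 + suc (h + h))) + suc (2 * (3 + suc (h + h)))
    below = solve-∀

  centre₁-placed : suc centre₁ < k ⊎ (2 * k < centre₁ × suc centre₁ < 3 * k + 3)
  centre₁-placed = inj₁ (subst (λ c → suc c < k) (sym centre₁≡) (<-by (suc h) (placed h)))
    where
    placed : ∀ h → suc (suc h) + suc (suc h) ≡ 3 + suc (h + h)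
    placed = solve-∀

  balanced₀ : ∀ t → OneOrTwo (C₀.redTriple t)
  balanced₀ t = subst OneOrTwo (sym (C₀.redTriple-at t level-k u₀≡))
    (OneOrTwo-swap (reds t N) (reds t (suc (k + suc h + suc k) + ℓ)) (reds t (k + suc h + suc k))
      (arc-balanced {suc (suc h)} {2 * k} (≤-by (7 + 3 * h) (f≤ℓ h)) (n≤1+n (2 * k)) (≤-by (suc h) (ℓ≤f+g h))
        N (suc (k + suc h + suc k) + ℓ) (k + suc h + suc k) 0
        (n%n≡0 N) (≡-mod (0 + suc (suc h)) 1 (second h)) (cong (_% N) (third h)) (toℕ t)))
    where
    level-k : C₀.levelAt k ≡ false
    level-k = cong (λ b → not (not (not (not b)))) (alternate-double false h)
    f≤ℓ : ∀ h → suc (suc h) + (7 + 3 * h) ≡ suc (2 * (3 + suc (h + h)))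
    f≤ℓ = solve-∀
    ℓ≤f+g : ∀ h → suc (2 * (3 + suc (h + h))) + suc h ≡ suc (suc h) + 2 * (3 + suc (h + h))
    ℓ≤f+g = solve-∀
    second : ∀ h → suc (3 + suc (h + h) + suc h + suc (3 + suc (h + h))) + suc (2 * (3 + suc (h + h)))
      ≡ 0 + suc (suc h) + 1 * (suc (2 * (3 + suc (h + h))) + suc (2 * (3 + suc (h + h))))
    second = solve-∀
    third : ∀ h → 3 + suc (h + h) + suc h + suc (3 + suc (h + h)) ≡ 0 + suc (suc h) + 2 * (3 + suc (h + h))
    third = solve-∀

  balanced₁ : ∀ t → OneOrTwo (C₁.redTriple t)
  balanced₁ t = subst OneOrTwo (sym (C₁.redTriple-at t level-k u₁≡))
    (OneOrTwo-reverse (reds t (suc (7 + 3 * h + 3 * k))) (reds t (7 + 3 * h + 3 * k + ℓ)) (reds t (k + ℓ))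
      (arc-balanced {2 * k} {3 + h} (n≤1+n (2 * k)) (≤-by (6 + 3 * h) (g≤ℓ h)) (≤-by (2 + h) (ℓ≤f+g h))
        (suc (7 + 3 * h + 3 * k)) (7 + 3 * h + 3 * k + ℓ) (k + ℓ) (2 + h)
        (≡-mod (2 + h) 1 (first h)) (≡-mod (2 + h + 2 * k) 1 (second h)) (cong (_% N) (third h)) (toℕ t)))
    where
    level-k : C₁.levelAt k ≡ true
    level-k = cong (λ b → not (not (not (not b)))) (alternate-double true h)
    g≤ℓ : ∀ h → 3 + h + (6 + 3 * h) ≡ suc (2 * (3 + suc (h + h)))
    g≤ℓ = solve-∀
    ℓ≤f+g : ∀ h → suc (2 * (3 + suc (h + h))) + (2 + h) ≡ 2 * (3 + suc (h + h)) + (3 + h)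
    ℓ≤f+g = solve-∀
    first : ∀ h → suc (7 + 3 * h + 3 * (3 + suc (h + h))) ≡ 2 + h + 1 * (suc (2 * (3 + suc (h + h))) + suc (2 * (3 + suc (h + h))))
    first = solve-∀
    second : ∀ h → 7 + 3 * h + 3 * (3 + suc (h + h)) + suc (2 * (3 + suc (h + h)))
      ≡ 2 + h + 2 * (3 + suc (h + h)) + 1 * (suc (2 * (3 + suc (h + h))) + suc (2 * (3 + suc (h + h))))
    second = solve-∀
    third : ∀ h → 3 + suc (h + h) + suc (2 * (3 + suc (h + h))) ≡ 2 + h + 2 * (3 + suc (h + h)) + (3 + h)
    third = solve-∀

  facts : ParityFacts
  facts = record
    { u₀-above = u₀-above ; u₀-below = u₀-below ; centre₁-placed = centre₁-placed
    ; balanced₀ = balanced₀ ; balanced₁ = balanced₁ }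

parityFacts : ∀ q → Construction.ParityFacts q
parityFacts q with parity q
... | inj₁ (h , refl) = EvenCase.facts h
... | inj₂ (h , refl) = OddCase.facts h

lemma2 : (k : ℕ) → 3 ≤ k →
  Σ ℕ λ m →
    (m ≡ k ∸ 2 ⊎ m ≡ k ∸ 1 ⊎ m ≡ k ⊎ m ≡ suc k) ×
    Σ (Cycle (suc (2 * k)) (2 * k)) λ C0 →
    Σ (Cycle (suc (2 * k)) (2 * k)) λ C1 →
      ((i : Fin (suc (2 * k))) →
        (isMixed (suc (2 * k)) (edge C0 i) ∨ isPureWith (suc (2 * k)) Fin.zero m (edge C0 i)) ≡ true) ×
      ((i : Fin (suc (2 * k))) →
        (isMixed (suc (2 * k)) (edge C1 i) ∨ isPureWith (suc (2 * k)) (Fin.suc Fin.zero) m (edge C1 i)) ≡ true) ×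
      ((d : Fin (suc (2 * k) + suc (2 * k))) → toℕ d ≢ 0 → toℕ d ≢ suc (2 * k) →
        countF (suc (2 * k)) (λ i → isMixedWith (suc (2 * k)) (toℕ d) (edge C0 i))
          + countF (suc (2 * k)) (λ i → isMixedWith (suc (2 * k)) (toℕ d) (edge C1 i)) ≡ 1) ×
      countF (suc (2 * k)) (λ i → isPureWith (suc (2 * k)) Fin.zero m (edge C0 i)) ≡ 1 ×
      countF (suc (2 * k)) (λ i → isPureWith (suc (2 * k)) (Fin.suc Fin.zero) m (edge C1 i)) ≡ 1 ×
      ((t : Fin (suc (2 * k) + suc (2 * k))) →
        (redCount (suc (2 * k)) C0 t ≡ k ⊎ redCount (suc (2 * k)) C0 t ≡ suc k) ×
        (redCount (suc (2 * k)) C1 t ≡ k ⊎ redCount (suc (2 * k)) C1 t ≡ suc k))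
lemma2 (suc (suc (suc q))) (s≤s (s≤s (s≤s _))) =
  k , inj₂ (inj₂ (inj₁ refl)) , C₀.cycle injective₀ , C₁.cycle injective₁ ,
  C₀.edges-allowed injective₀ k pure₀ , C₁.edges-allowed injective₁ k pure₁ ,
  (λ d d≢0 d≢ℓ → trans (cong₂ _+_ (C₀.mixed-count injective₀ (toℕ d)) (C₁.mixed-count injective₁ (toℕ d)))
                        (hits-partition (toℕ d) (n≢0⇒n>0 d≢0) (toℕ<n d) (d≢ℓ ∘ sym))) ,
  C₀.pure-count injective₀ k pure₀ , C₁.pure-count injective₁ k pure₁ ,
  (λ t → C₀.equitable injective₀ t (balanced₀ t) , C₁.equitable injective₁ t (balanced₁ t))
  where
  open Construction q
  open ParityFacts (parityFacts q)
  injective₀ : C₀.ValueInjective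
  injective₀ = value-injective₀ u₀-above u₀-below
  injective₁ : C₁.ValueInjective
  injective₁ = value-injective₁ centre₁-placed
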